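{- Let $D\ge2$ be squarefree, $K=\mathbb{Q}(\sqrt D)$, $j\in\mathbb{Z}$, and $\alpha=3\beta_j$. Then: if $v_j\ge4$, $p_K(\alpha)=3$; if $v_j=3$, $p_K(\alpha)=4$; if $v_j=2$, $v_{j-1}>2$ and $v_{j+1}>2$, then $p_K(\alpha)=6$; if $v_j=2$ and ($v_{j-1}=2$ or $v_{j+1}=2$), then $p_K(\alpha)\ge8$.
   Context: $\mathcal{O}_K^+$: totally positive integers of $K$; $p_K(\alpha)$ is the number of unordered representations $\alpha=\lambda_1+\dots+\lambda_\ell$ ($\ell\ge1$, $\lambda_i\in\mathcal{O}_K^+$). Notation: $\omega_D=\sqrt D$, $\xi_D=\sqrt D$ if $D\equiv2,3\pmod4$; $\omega_D=(1+\sqrt D)/2$, $\xi_D=(\sqrt D-1)/2$ if $D\equiv1\pmod4$. Write $\omega_D=[\lceil u_0/2\rceil;\overline{u_1,\dots,u_s}]$ with $u_s=u_0$ (indices extended periodically). Let $p_{ -1}=1,q_{ -1}=0$, $p_0=\lceil u_0/2\rceil,q_0=1$, $p_{i+2}=u_{i+2}p_{i+1}+p_i$, $q_{i+2}=u_{i+2}q_{i+1}+q_i$, $\alpha_i=p_i+q_i\xi_D$, $\alpha_{i,r}=\alpha_i+r\alpha_{i+1}$. The indecomposables of $\mathcal{O}_K^+$ (elements not a sum of two elements of $\mathcal{O}_K^+$) are the $\alpha_{i,r}$ ($i\ge-1$ odd, $0\le r\le u_{i+2}-1$) and their Galois conjugates, ordered as $\dots<\beta_{ -1}<\beta_0=1<\beta_1<\dots$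 with $\beta_{ -j}=\beta_j'$ ($\beta_j$, $j\ge0$, runs through the $\alpha_{i,r}$ in lexicographic order of $(i,r)$). For $j\in\mathbb{Z}$, $v_j=2$ if $\beta_{|j|}=\alpha_{i,r}$ with $1\le r\le u_{i+2}-1$, and $v_j=u_{i+1}+2$ if $\beta_{|j|}=\alpha_{i,0}$; one has $v_j\beta_j=\beta_{j-1}+\beta_{j+1}$. -}

module Defs where

open import Data.Bool using (Bool; true; false; if_then_else_; _∧_; T)
open import Data.Nat as ℕ using (ℕ; zero; suc; _∸_; _≡ᵇ_; _<ᵇ_; _≤ᵇ_)
open import Data.Nat.DivMod using (_/_; _%_)
open import Data.Nat.Divisibility using (_∣_)
open import Data.Integer as ℤ using (ℤ; +_; -[1+_]; ∣_∣)
import Data.Integer.Properties as ℤP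
open import Data.Product using (_×_; _,_; proj₁; proj₂; Σ)
open import Data.List using (List; []; _∷_)
open import Relation.Nullary.Decidable using (⌊_⌋)
open import Relation.Binary.PropositionalEquality using (_≡_)

Squarefree : ℕ → Set
Squarefree D = ∀ (p : ℕ) → (p ℕ.* p) ∣ D → p ≡ 1

-- Elements of O_K, K = Q(√D), written in the integral basis (1, ω_D):
-- the pair (x , y) stands for x + y ω_D.

OK : Set
OK = ℤ × ℤ

one-mod-4 : ℕ → Bool
one-mod-4 D = (D % 4) ≡ᵇ 1

_⊕_ : OK → OK → OK
(a , b) ⊕ (c , d) = (a ℤ.+ c , b ℤ.+ d)

scale : ℤ → OK → OK
scale n (a , b) = (n ℤ.* a , n ℤ.* b)

zeroOK : OK
zeroOK = (+ 0 , + 0)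

-- Galois conjugation: ω' = -ω  (D ≡ 2,3),  ω' = 1 - ω  (D ≡ 1 mod 4)
conj : ℕ → OK → OK
conj D (x , y) = if one-mod-4 D then (x ℤ.+ y , ℤ.- y) else (x , ℤ.- y)

-- x + y ω_D = (t + y √D) / c with c = 1 or 2; t as below.
-- Both real embeddings (t ± y√D)/c are positive iff t > 0 and t² > D y²
-- (D is not a square, so t² = D y² with y ≠ 0 is impossible).
totPos : ℕ → OK → Bool
totPos D (x , y) =
  let t = if one-mod-4 D then (+ 2) ℤ.* x ℤ.+ y else x in
  ⌊ + 0 ℤ.<? t ⌋ ∧ ⌊ (+ D) ℤ.* (y ℤ.* y) ℤ.<? t ℤ.* t ⌋

-- A multiset is represented canonically by the
-- list of its elements sorted non-increasingly in the lexicographic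
-- order on (x , y).

_≤lex_ : OK → OK → Bool
(a , b) ≤lex (c , d) = ⌊ a ℤ.<? c ⌋ ∨' (⌊ a ℤ.≟ c ⌋ ∧ ⌊ b ℤ.≤? d ⌋)
  where
  _∨'_ : Bool → Bool → Bool
  true ∨' _ = true
  false ∨' b = b

_==OK_ : OK → OK → Bool
(a , b) ==OK (c , d) = ⌊ a ℤ.≟ c ⌋ ∧ ⌊ b ℤ.≟ d ⌋

sumOK : List OK → OK
sumOK [] = zeroOK
sumOK (x ∷ xs) = x ⊕ sumOK xs

allTotPos : ℕ → List OK → Bool
allTotPos D [] = true
allTotPos D (x ∷ xs) = totPos D x ∧ allTotPos D xs

nonIncreasing : List OK → Bool
nonIncreasing [] = true
nonIncreasing (x ∷ []) = true
nonIncreasing (x ∷ y ∷ xs) = (y ≤lex x) ∧ nonIncreasing (y ∷ xs)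

nonEmpty : List OK → Bool
nonEmpty [] = false
nonEmpty (_ ∷ _) = true

isPartition : ℕ → OK → List OK → Bool
isPartition D α l =
  nonEmpty l ∧ allTotPos D l ∧ nonIncreasing l ∧ (sumOK l ==OK α)

-- The set of partitions of α; p_K(α) is its cardinality.
Partition : ℕ → OK → Set
Partition D α = Σ (List OK) (λ l → T (isPartition D α l))

-- Complete quotients x_n = (P_n + √D)/Q_n with x_0 = ω_D
-- ((P,Q) = (0,1) for D ≡ 2,3, (1,2) for D ≡ 1 mod 4),
-- a_n = ⌊x_n⌋ = ⌊(P_n + ⌊√D⌋)/Q_n⌋, x_{n+1} = 1/(x_n - a_n), i.e.
-- P_{n+1} = a_n Q_n - P_n, Q_{n+1} = (D - P_{n+1}²)/Q_n.

isqrt : ℕ → ℕ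
isqrt zero = zero
isqrt (suc n) =
  let s = isqrt n in
  if (suc s ℕ.* suc s) ≤ᵇ suc n then suc s else s

div' : ℕ → ℕ → ℕ
div' m zero = zero
div' m (suc n) = m / suc n

cfState : ℕ → ℕ → ℕ × ℕ
cfState D zero = if one-mod-4 D then (1 , 2) else (0 , 1)
cfState D (suc n) =
  let P = proj₁ (cfState D n)
      Q = proj₂ (cfState D n)
      a = div' (P ℕ.+ isqrt D) Q
      P' = a ℕ.* Q ∸ P
  in (P' , div' (D ∸ P' ℕ.* P') Q)

pq : ℕ → ℕ → ℕ
pq D n = div' (proj₁ (cfState D n) ℕ.+ isqrt D) (proj₂ (cfState D n))

-- u_n : u_n = a_n for n ≥ 1, and u_0 = u_s (last element of the period),
-- which equals 2a_0 (D ≡ 2,3) resp. 2a_0 - 1 (D ≡ 1 mod 4), so that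
-- ⌈u_0/2⌉ = a_0.
u : ℕ → ℕ → ℕ
u D zero = if one-mod-4 D then 2 ℕ.* pq D 0 ∸ 1 else 2 ℕ.* pq D 0
u D (suc n) = pq D (suc n)

-- shifted convergents: pp D k = p_{k-1}, qq D k = q_{k-1}
pp : ℕ → ℕ → ℕ
pp D zero = 1
pp D (suc zero) = pq D 0
pp D (suc (suc n)) = u D (suc n) ℕ.* pp D (suc n) ℕ.+ pp D n

qq : ℕ → ℕ → ℕ
qq D zero = 0
qq D (suc zero) = 1
qq D (suc (suc n)) = u D (suc n) ℕ.* qq D (suc n) ℕ.+ qq D n

-- α_{k-1} = p_{k-1} + q_{k-1} ξ_D, with ξ_D = ω_D (D ≡ 2,3), ω_D - 1 (D ≡ 1)
alphaShift : ℕ → ℕ → OK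
alphaShift D k =
  if one-mod-4 D
  then (+ pp D k ℤ.- + qq D k , + qq D k)
  else (+ pp D k , + qq D k)

-- α_{i,r} for odd i = 2k - 1 ≥ -1
alphaIR : ℕ → ℕ → ℕ → OK
alphaIR D k r =
  alphaShift D (2 ℕ.* k) ⊕ scale (+ r) (alphaShift D (suc (2 ℕ.* k)))

-- index (k , r) (i = 2k - 1) of β_j, j ≥ 0, in lexicographic order;
-- 0 ≤ r ≤ u_{i+2} - 1 = u_{2k+1} - 1
idx : ℕ → ℕ → ℕ × ℕ
idx D zero = (0 , 0)
idx D (suc j) =
  let k = proj₁ (idx D j)
      r = proj₂ (idx D j)
  in if suc r <ᵇ u D (suc (2 ℕ.* k)) then (k , suc r) else (suc k , 0)

βℕ : ℕ → ℕ → OK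
βℕ D j = alphaIR D (proj₁ (idx D j)) (proj₂ (idx D j))

β : ℕ → ℤ → OK
β D (+ n) = βℕ D n
β D (-[1+ n ]) = conj D (βℕ D (suc n))

v : ℕ → ℤ → ℕ
v D j =
  let k = proj₁ (idx D ∣ j ∣)
      r = proj₂ (idx D ∣ j ∣)
  in if r ≡ᵇ 0 then u D (2 ℕ.* k) ℕ.+ 2 else 2

-- Put β₋ = β_{j-1}, β = β_j, β₊ = β_{j+1}.  The pair (β₋, β) is a basis of O_K with
-- β₋ + β₊ = v_j β, and β₋ - β, β₊ - β (and 2β₊ - β, 2β₋ - β when the neighbouring v exceed 2)
-- have negative norm.  A line through an element of negative norm misses the totally positive
-- cone, so each such element gives an integral linear form that is positive on every totally
-- positive element.  On the parts of a partition of 3β these forms are positive and add up to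
-- their value at 3β; in the coordinates z = a β₋ + b β this confines the parts to a few points,
-- and the partitions are then found by a finite search.  If v_j = 2 and a neighbour also has
-- v = 2, then β_{j±2} = 2β_{j±1} - β is totally positive and gives two further partitions.
-- The properties of the β_j come from the continued fraction of ω_D: the β_j are the elements
-- α_i + r α_{i+1} between consecutive convergents, whose norms alternate in sign.

module Submission where

open import Defs
open import Data.Bool using (Bool; true; false; if_then_else_; _∧_; T)
open import Data.Bool.Properties using (T-∧; T-irrelevant)
open import Data.Empty using (⊥-elim)
open import Data.Fin using (Fin)
import Data.Fin.Properties as FinP
open import Data.Integer as ℤ using (ℤ; +_; -[1+_]; _+_; _*_; -_; _-_; _<_; _≤_; 0ℤ; 1ℤ; +<+; +≤+)
import Data.Integer.Properties as ℤP
open import Data.Integer.Tactic.RingSolver using (solve-∀)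
open import Data.List using (List; []; _∷_; _++_; map; length; foldr; lookup; cartesianProductWith; filter; applyUpTo)
open import Data.List.Membership.Propositional using (_∈_)
open import Data.List.Membership.Propositional.Properties
  using (∈-++⁺ˡ; ∈-++⁺ʳ; ∈-cartesianProductWith⁺; ∈-map⁺; ∈-applyUpTo⁺; ∈-filter⁺; ∈-lookup)
import Data.List.Properties as ListP
open import Data.List.Relation.Binary.Permutation.Propositional using (_↭_; ↭-sym; ↭-trans; ↭⇒↭ₛ; prep; swap)
import Data.List.Relation.Binary.Permutation.Propositional as Perm
open import Data.List.Relation.Binary.Permutation.Propositional.Properties using (All-resp-↭; ↭-length)
import Data.List.Relation.Binary.Permutation.Propositional.Properties as Perm
open import Data.List.Relation.Binary.Pointwise using (Pointwise-≡⇒≡)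
open import Data.List.Relation.Unary.All using (All; []; _∷_)
import Data.List.Relation.Unary.All as All
import Data.List.Relation.Unary.All.Properties as All
open import Data.List.Relation.Unary.Any using (Any; here; there)
import Data.List.Relation.Unary.Any as Any
import Data.List.Relation.Unary.Any.Properties as AnyP
open import Data.List.Relation.Unary.Linked using ([]; [-]; _∷_)
import Data.List.Relation.Unary.Sorted.TotalOrder as SortedList
import Data.List.Relation.Unary.Sorted.TotalOrder.Properties as SortedListProperties
import Data.List.Sort.InsertionSort.Base as InsertionSort
import Data.List.Sort.InsertionSort.Properties as InsertionSortProperties
import Data.Nat as ℕ
open import Data.Nat using (ℕ; zero; suc; z≤n; s≤s; _∸_)
open import Data.Nat.DivMod using (_/_; _%_; m≡m%n+[m/n]*n; m%n<n; m*n/n≡m; m≥n⇒m/n>0)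
open import Data.Nat.Divisibility using (divides)
import Data.Nat.Properties as ℕP
import Data.Nat.Tactic.RingSolver as ℕSolver
open import Data.Product using (_×_; _,_; proj₁; proj₂; Σ; ∃)
import Data.Product.Properties as ×P
open import Data.Sum using (_⊎_; inj₁; inj₂)
import Data.Sum as Sum
open import Data.Unit using (tt)
open import Function.Base using (_∘_)
open import Function.Bundles using (Equivalence; _⤖_; _↣_; mk⤖; mk↣)
open import Level using (0ℓ)
open import Relation.Binary.Bundles using (DecTotalOrder)
open import Relation.Binary.Definitions using (tri<; tri≈; tri>)
open import Relation.Binary.PropositionalEquality
  using (_≡_; _≢_; refl; sym; trans; cong; cong₂; subst; subst₂; isEquivalence; module ≡-Reasoning)
open import Relation.Nullary using (¬_; Dec; yes; no; _×-dec_)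
open import Relation.Nullary.Decidable using (toWitness; fromWitness; T?; from-yes; _→-dec_)

cong₄ : ∀ {A : Set} (f : A → A → A → A → A) {a b c d a′ b′ c′ d′} →
  a ≡ a′ → b ≡ b′ → c ≡ c′ → d ≡ d′ → f a b c d ≡ f a′ b′ c′ d′
cong₄ f refl refl refl refl = refl

i<j⇒0<j-i : ∀ {i j} → i < j → 0ℤ < j - i
i<j⇒0<j-i {i} {j} i<j = subst (_< j - i) (ℤP.+-inverseʳ i) (ℤP.+-monoˡ-< (- i) i<j)

0<j-i⇒i<j : ∀ {i j} → 0ℤ < j - i → i < j
0<j-i⇒i<j {i} {j} 0<j-i = subst₂ _<_ (ℤP.+-identityˡ i) (cancel j i) (ℤP.+-monoˡ-< i 0<j-i)
  where
  cancel : ∀ j i → j - i + i ≡ j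
  cancel = solve-∀

0<i⇒1≤i : ∀ {i} → 0ℤ < i → 1ℤ ≤ i
0<i⇒1≤i = ℤP.i<j⇒suc[i]≤j

i<j⇒i+1≤j : ∀ {i j} → i < j → i + 1ℤ ≤ j
i<j⇒i+1≤j {i} {j} i<j = subst (_≤ j) (ℤP.+-comm 1ℤ i) (ℤP.i<j⇒suc[i]≤j i<j)

*-pos : ∀ {i j} → 0ℤ < i → 0ℤ < j → 0ℤ < i * j
*-pos {+ suc m} {+ suc n} _ _ = +<+ (s≤s z≤n)
*-pos {+ zero} (+<+ ())
*-pos {+ suc m} {+ zero} _ (+<+ ())

*-nonNeg : ∀ {i j} → 0ℤ ≤ i → 0ℤ ≤ j → 0ℤ ≤ i * j
*-nonNeg {+ m} {+ n} _ _ = subst (0ℤ ≤_) (ℤP.pos-* m n) (+≤+ z≤n)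

square-nonNeg : ∀ i → 0ℤ ≤ i * i
square-nonNeg (+ n) = *-nonNeg {+ n} (+≤+ z≤n) (+≤+ z≤n)
square-nonNeg -[1+ n ] = +≤+ z≤n

square-pos : ∀ {i} → i ≢ 0ℤ → 0ℤ < i * i
square-pos {+ zero} i≢0 = ⊥-elim (i≢0 refl)
square-pos {+ suc n} _ = *-pos {+ suc n} (+<+ (s≤s z≤n)) (+<+ (s≤s z≤n))
square-pos { -[1+ n ]} _ = +<+ (s≤s z≤n)

*-pos-cancelˡ : ∀ {i j} → 0ℤ < i → 0ℤ < i * j → 0ℤ < j
*-pos-cancelˡ {i} {j} 0<i 0<ij = ℤP.*-cancelˡ-<-nonNeg i {{ℤ.nonNegative (ℤP.<⇒≤ 0<i)}}
  (subst (_< i * j) (sym (ℤP.*-zeroʳ i)) 0<ij)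

*-pos-monoˡ-< : ∀ {i j k} → 0ℤ < k → i < j → k * i < k * j
*-pos-monoˡ-< {k = k} 0<k = ℤP.*-monoˡ-<-pos k {{ℤ.positive 0<k}}

*-pos-monoʳ-< : ∀ {i j k} → 0ℤ < k → i < j → i * k < j * k
*-pos-monoʳ-< {k = k} 0<k = ℤP.*-monoʳ-<-pos k {{ℤ.positive 0<k}}

*-nonNeg-monoˡ-≤ : ∀ {i j k} → 0ℤ ≤ k → i ≤ j → k * i ≤ k * j
*-nonNeg-monoˡ-≤ {k = k} 0≤k = ℤP.*-monoˡ-≤-nonNeg k {{ℤ.nonNegative 0≤k}}

square-<⇒< : ∀ {i j} → 0ℤ < j → i * i < j * j → i < j
square-<⇒< {i} {j} 0<j i²<j² with ℤP.≤-total j i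
... | inj₂ i≤j = ℤP.≤∧≢⇒< i≤j (λ { refl → ℤP.<-irrefl refl i²<j² })
... | inj₁ j≤i = ⊥-elim (ℤP.<-irrefl refl (ℤP.<-≤-trans i²<j² (ℤP.≤-trans j²≤ji ji≤i²)))
  where
  j²≤ji : j * j ≤ j * i
  j²≤ji = *-nonNeg-monoˡ-≤ (ℤP.<⇒≤ 0<j) j≤i
  ji≤i² : j * i ≤ i * i
  ji≤i² = ℤP.*-monoʳ-≤-nonNeg i {{ℤ.nonNegative (ℤP.≤-trans (ℤP.<⇒≤ 0<j) j≤i)}} j≤i

quadratic-pos-between : ∀ A B C r u → 0ℤ ≤ r → r ≤ u → C ≤ 0ℤ →
  0ℤ < A → 0ℤ < A + B * u + C * (u * u) → 0ℤ < A + B * r + C * (r * r)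
quadratic-pos-between A B C (+ zero) u _ _ _ 0<A _ = subst (0ℤ <_) (at-zero A B C) 0<A
  where
  at-zero : ∀ A B C → A ≡ A + B * 0ℤ + C * (0ℤ * 0ℤ)
  at-zero = solve-∀
quadratic-pos-between A B C r@(+ suc m) u _ r≤u C≤0 0<A 0<at-u =
  *-pos-cancelˡ 0<u (subst (0ℤ <_) (sym (interpolation A B C r u)) 0<sum)
  where
  0<r : 0ℤ < r
  0<r = +<+ (s≤s z≤n)
  0<u : 0ℤ < u
  0<u = ℤP.<-≤-trans 0<r r≤u
  0<sum : 0ℤ < (u - r) * A + r * (A + B * u + C * (u * u)) + (- C) * (r * u * (u - r))
  0<sum = ℤP.+-mono-<-≤
    (ℤP.+-mono-≤-< (*-nonNeg (ℤP.i≤j⇒0≤j-i r≤u) (ℤP.<⇒≤ 0<A)) (*-pos 0<r 0<at-u))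
    (*-nonNeg (ℤP.neg-mono-≤ C≤0)
      (*-nonNeg (*-nonNeg (ℤP.<⇒≤ 0<r) (ℤP.<⇒≤ 0<u)) (ℤP.i≤j⇒0≤j-i r≤u)))
  interpolation : ∀ A B C r u → u * (A + B * r + C * (r * r)) ≡
    (u - r) * A + r * (A + B * u + C * (u * u)) + (- C) * (r * u * (u - r))
  interpolation = solve-∀

quadratic-neg-between : ∀ A B C r u → 0ℤ ≤ r → r ≤ u → 0ℤ ≤ C →
  A < 0ℤ → A + B * u + C * (u * u) < 0ℤ → A + B * r + C * (r * r) < 0ℤ
quadratic-neg-between A B C r u 0≤r r≤u 0≤C A<0 at-u<0 =
  ℤP.neg-cancel-< {0ℤ} (subst (0ℤ <_) (sym (negate A B C r))
    (quadratic-pos-between (- A) (- B) (- C) r u 0≤r r≤u (ℤP.neg-mono-≤ 0≤C)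
      (ℤP.neg-mono-< A<0) (subst (0ℤ <_) (negate A B C u) (ℤP.neg-mono-< at-u<0))))
  where
  negate : ∀ A B C x → - (A + B * x + C * (x * x)) ≡ - A + - B * x + - C * (x * x)
  negate = solve-∀

i<i+j : ∀ i {j} → 0ℤ < j → i < i + j
i<i+j i {j} 0<j = subst (_< i + j) (ℤP.+-identityʳ i) (ℤP.+-monoʳ-< i 0<j)

sumℤ : List ℤ → ℤ
sumℤ = foldr _+_ 0ℤ

sumℤ-nonNeg : ∀ {xs} → All (0ℤ <_) xs → 0ℤ ≤ sumℤ xs
sumℤ-nonNeg [] = ℤP.≤-refl
sumℤ-nonNeg (0<x ∷ 0<xs) = ℤP.+-mono-≤ (ℤP.<⇒≤ 0<x) (sumℤ-nonNeg 0<xs)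

sumℤ-pos : ∀ {x xs} → All (0ℤ <_) (x ∷ xs) → 0ℤ < sumℤ (x ∷ xs)
sumℤ-pos (0<x ∷ 0<xs) = ℤP.+-mono-<-≤ 0<x (sumℤ-nonNeg 0<xs)

≤-sumℤ : ∀ {xs} → All (0ℤ <_) xs → All (_≤ sumℤ xs) xs
≤-sumℤ [] = []
≤-sumℤ {x ∷ xs} (0<x ∷ 0<xs) = ℤP.i≤i+j x (sumℤ xs) {{ℤ.nonNegative (sumℤ-nonNeg 0<xs)}}
  ∷ All.map (λ y≤Σ → ℤP.≤-trans y≤Σ (ℤP.i≤j+i (sumℤ xs) x {{ℤ.nonNegative (ℤP.<⇒≤ 0<x)}})) (≤-sumℤ 0<xs)

<-sumℤ : ∀ {xs} → All (0ℤ <_) xs → 2 ℕ.≤ length xs → All (_< sumℤ xs) xs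
<-sumℤ {x ∷ xs@(_ ∷ _)} (0<x ∷ 0<xs) _ = i<i+j x (sumℤ-pos 0<xs)
  ∷ All.map (λ y≤Σ → ℤP.≤-<-trans y≤Σ (subst (_< x + sumℤ xs) (ℤP.+-identityˡ (sumℤ xs)) (ℤP.+-monoˡ-< (sumℤ xs) 0<x)))
      (≤-sumℤ 0<xs)
<-sumℤ {_ ∷ []} _ (s≤s ())

length≤sumℤ : ∀ {xs} → All (0ℤ <_) xs → + length xs ≤ sumℤ xs
length≤sumℤ [] = ℤP.≤-refl
length≤sumℤ {x ∷ xs} (0<x ∷ 0<xs) = subst (_≤ x + sumℤ xs) (sym (ℤP.pos-+ 1 (length xs)))
  (ℤP.+-mono-≤ (0<i⇒1≤i 0<x) (length≤sumℤ 0<xs))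

small-multiple≡0 : ∀ {k a} → 2 ℕ.≤ k → - + 2 < + k * a → + k * a < + 2 → a ≡ 0ℤ
small-multiple≡0 {k} {+ zero} _ _ _ = refl
small-multiple≡0 {k} {+ suc n} 2≤k _ ka<2 = ⊥-elim (ℕP.<⇒≱ (ℤP.drop‿+<+ (subst (_< + 2) (sym (ℤP.pos-* k (suc n))) ka<2))
  (ℕP.≤-trans 2≤k (ℕP.m≤m*n k (suc n))))
small-multiple≡0 {k} { -[1+ n ]} 2≤k -2<ka _ = ⊥-elim (ℕP.<⇒≱ (ℤP.drop‿+<+ (subst (_< + 2) (sym (ℤP.pos-* k (suc n)))
  (ℤP.neg-cancel-< (subst (- + 2 <_) (sym (ℤP.neg-distribʳ-* (+ k) (+ suc n))) -2<ka))))
  (ℕP.≤-trans 2≤k (ℕP.m≤m*n k (suc n))))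

difference-bounds : ∀ {x y} → 0ℤ < x → x < + 3 → 0ℤ < y → y < + 3 → - + 2 < y - x × y - x < + 2
difference-bounds 0<x x<3 0<y y<3 =
  ℤP.+-mono-≤-< (0<i⇒1≤i 0<y) (ℤP.neg-mono-< x<3) , ℤP.+-mono-<-≤ y<3 (ℤP.neg-mono-≤ (0<i⇒1≤i 0<x))

*-cancelˡ-≡0 : ∀ {q x} → 0ℤ < q → q * x ≡ 0ℤ → x ≡ 0ℤ
*-cancelˡ-≡0 {q} 0<q qx≡0 with ℤP.i*j≡0⇒i≡0∨j≡0 q qx≡0
... | inj₁ refl = ⊥-elim (ℤP.<-irrefl refl 0<q)
... | inj₂ x≡0 = x≡0

square-neg : ∀ i → - i * - i ≡ i * i
square-neg = solve-∀

infixl 6 _⊖_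

_⊖_ : OK → OK → OK
(a , b) ⊖ (c , d) = (a - c , b - d)

neg : OK → OK
neg (a , b) = (- a , - b)

_≟ₒ_ : (a b : OK) → Dec (a ≡ b)
_≟ₒ_ = ×P.≡-dec ℤ._≟_ ℤ._≟_

det : OK → OK → ℤ
det (a , b) (c , d) = a * d - b * c

⊕-comm : ∀ a b → a ⊕ b ≡ b ⊕ a
⊕-comm (x , y) (x′ , y′) = cong₂ _,_ (ℤP.+-comm x x′) (ℤP.+-comm y y′)

⊕-assoc : ∀ a b c → (a ⊕ b) ⊕ c ≡ a ⊕ (b ⊕ c)
⊕-assoc (x , y) (x′ , y′) (x″ , y″) = cong₂ _,_ (ℤP.+-assoc x x′ x″) (ℤP.+-assoc y y′ y″)

⊕-identityʳ : ∀ a → a ⊕ zeroOK ≡ a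
⊕-identityʳ (x , y) = cong₂ _,_ (ℤP.+-identityʳ x) (ℤP.+-identityʳ y)

⊕-scale-zero : ∀ X Y → X ⊕ scale 0ℤ Y ≡ X
⊕-scale-zero (a , b) (c , d) = cong₂ _,_ (vanish a c) (vanish b d)
  where
  vanish : ∀ a c → a + 0ℤ * c ≡ a
  vanish = solve-∀

⊕-scale-suc : ∀ X Z r → X ⊕ scale (+ suc r) Z ≡ (X ⊕ scale (+ r) Z) ⊕ Z
⊕-scale-suc (a , b) (c , d) r = cong₂ _,_ (step a c) (step b d)
  where
  linear : ∀ a c r → a + (+ 1 + r) * c ≡ a + r * c + c
  linear = solve-∀
  step : ∀ a c → a + + suc r * c ≡ a + + r * c + c
  step a c = trans (cong (λ w → a + w * c) (ℤP.pos-+ 1 r)) (linear a c (+ r))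

⊕-double : ∀ X d → X ⊕ ((X ⊕ d) ⊕ d) ≡ scale (+ 2) (X ⊕ d)
⊕-double (a , b) (c , d) = cong₂ _,_ (double a c) (double b d)
  where
  double : ∀ a c → a + ((a + c) + c) ≡ + 2 * (a + c)
  double = solve-∀

⊕-shear : ∀ X Y Z n → Y ≡ X ⊕ Z → X ⊕ (Y ⊕ (scale (+ n) Y ⊕ Z)) ≡ scale (+ (n ℕ.+ 2)) Y
⊕-shear (a , b) _ (c , d) n refl = cong₂ _,_ (collect a c) (collect b d)
  where
  linear : ∀ a c n → a + ((a + c) + (n * (a + c) + c)) ≡ (n + + 2) * (a + c)
  linear = solve-∀
  collect : ∀ a c → a + ((a + c) + (+ n * (a + c) + c)) ≡ + (n ℕ.+ 2) * (a + c)
  collect a c = trans (linear a c (+ n)) (cong (_* (a + c)) (sym (ℤP.pos-+ n 2)))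

⊕-solve : ∀ a b c → a ⊕ b ≡ c → b ≡ neg a ⊕ c
⊕-solve (a₁ , a₂) (b₁ , b₂) _ refl = cong₂ _,_ (cancel a₁ b₁) (cancel a₂ b₂)
  where
  cancel : ∀ a b → b ≡ - a + (a + b)
  cancel = solve-∀

⊕-trace : ∀ a b c n → b ⊕ c ≡ scale n a → (a ⊕ b) ⊕ (a ⊕ c) ≡ scale (n + + 2) a
⊕-trace (a₁ , a₂) (b₁ , b₂) (c₁ , c₂) n b+c≡na =
  cong₂ _,_ (collect a₁ b₁ c₁ (cong proj₁ b+c≡na)) (collect a₂ b₂ c₂ (cong proj₂ b+c≡na))
  where
  regroup : ∀ a b c → (a + b) + (a + c) ≡ (b + c) + (a + a)
  regroup = solve-∀
  expand : ∀ n a → n * a + (a + a) ≡ (n + + 2) * a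
  expand = solve-∀
  collect : ∀ a b c → b + c ≡ n * a → (a + b) + (a + c) ≡ (n + + 2) * a
  collect a b c h = trans (regroup a b c) (trans (cong (_+ (a + a)) h) (expand n a))

⊕≡⇒⊖ˡ : ∀ {X Y W} → X ⊕ Y ≡ W → W ⊖ X ≡ Y
⊕≡⇒⊖ˡ {x₁ , x₂} {y₁ , y₂} refl = cong₂ _,_ (cancel x₁ y₁) (cancel x₂ y₂)
  where
  cancel : ∀ x y → x + y - x ≡ y
  cancel = solve-∀

⊕≡⇒⊖ʳ : ∀ {X Y W} → X ⊕ Y ≡ W → W ⊖ Y ≡ X
⊕≡⇒⊖ʳ {x₁ , x₂} {y₁ , y₂} refl = cong₂ _,_ (cancel x₁ y₁) (cancel x₂ y₂)
  where
  cancel : ∀ x y → x + y - y ≡ x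
  cancel = solve-∀

⊖-⊕ : ∀ X Y → X ⊖ (X ⊕ Y) ≡ neg Y
⊖-⊕ (a , b) (c , d) = cong₂ _,_ (cancel a c) (cancel b d)
  where
  cancel : ∀ a c → a - (a + c) ≡ - c
  cancel = solve-∀

⊖-anticomm : ∀ X Y → X ⊖ Y ≡ neg (Y ⊖ X)
⊖-anticomm (a , b) (c , d) = cong₂ _,_ (flip a c) (flip b d)
  where
  flip : ∀ a c → a - c ≡ - (c - a)
  flip = solve-∀

twice-⊖-summand : ∀ X Z → scale (+ 2) (X ⊕ Z) ⊖ X ≡ Z ⊕ scale 1ℤ (X ⊕ Z)
twice-⊖-summand (a , b) (c , d) = cong₂ _,_ (regroup a c) (regroup b d)
  where
  regroup : ∀ a c → + 2 * (a + c) - a ≡ c + 1ℤ * (a + c)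
  regroup = solve-∀

twice-⊖-sum : ∀ X W → scale (+ 2) X ⊖ (X ⊕ W) ≡ X ⊖ W
twice-⊖-sum (a , b) (c , d) = cong₂ _,_ (regroup a c) (regroup b d)
  where
  regroup : ∀ a c → + 2 * a - (a + c) ≡ a - c
  regroup = solve-∀

⊖-⊕-scale-suc : ∀ X Y n → X ⊖ (Y ⊕ scale (+ suc n) X) ≡ neg (Y ⊕ scale (+ n) X)
⊖-⊕-scale-suc (a , b) (c , d) n = cong₂ _,_ (regroup a c) (regroup b d)
  where
  linear : ∀ a c n → a - (c + (+ 1 + n) * a) ≡ - (c + n * a)
  linear = solve-∀
  regroup : ∀ a c → a - (c + + suc n * a) ≡ - (c + + n * a)
  regroup a c = trans (cong (λ w → a - (c + w * a)) (ℤP.pos-+ 1 n)) (linear a c (+ n))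

det-⊕ʳ-self : ∀ X Y → det X (X ⊕ Y) ≡ det X Y
det-⊕ʳ-self (a , b) (c , d) = cancel a b c d
  where
  cancel : ∀ a b c d → a * (b + d) - b * (a + c) ≡ a * d - b * c
  cancel = solve-∀

det-⊕ˡ-scale : ∀ X Z r → det (X ⊕ scale r Z) Z ≡ det X Z
det-⊕ˡ-scale (a , b) (c , d) r = cancel a b c d r
  where
  cancel : ∀ a b c d r → (a + r * c) * d - (b + r * d) * c ≡ a * d - b * c
  cancel = solve-∀

det-swap : ∀ a b → det a b ≡ - det b a
det-swap (x , y) (x′ , y′) = flip x y x′ y′
  where
  flip : ∀ x y x′ y′ → x * y′ - y * x′ ≡ - (x′ * y - y′ * x)
  flip = solve-∀

det-relation : ∀ g e f w → g ⊕ f ≡ scale w e → det f e ≡ - det g e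
det-relation (g₁ , g₂) (e₁ , e₂) (f₁ , f₂) w g+f≡we = begin
  f₁ * e₂ - f₂ * e₁                                      ≡⟨ rearrange g₁ g₂ e₁ e₂ f₁ f₂ ⟩
  (g₁ + f₁) * e₂ - (g₂ + f₂) * e₁ - (g₁ * e₂ - g₂ * e₁)
    ≡⟨ cong₂ (λ x y → x * e₂ - y * e₁ - (g₁ * e₂ - g₂ * e₁)) (cong proj₁ g+f≡we) (cong proj₂ g+f≡we) ⟩
  w * e₁ * e₂ - w * e₂ * e₁ - (g₁ * e₂ - g₂ * e₁)        ≡⟨ cancel w e₁ e₂ g₁ g₂ ⟩
  - (g₁ * e₂ - g₂ * e₁)                                  ∎
  where
  open ≡-Reasoning
  rearrange : ∀ g₁ g₂ e₁ e₂ f₁ f₂ → f₁ * e₂ - f₂ * e₁ ≡ (g₁ + f₁) * e₂ - (g₂ + f₂) * e₁ - (g₁ * e₂ - g₂ * e₁)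
  rearrange = solve-∀
  cancel : ∀ w e₁ e₂ g₁ g₂ → w * e₁ * e₂ - w * e₂ * e₁ - (g₁ * e₂ - g₂ * e₁) ≡ - (g₁ * e₂ - g₂ * e₁)
  cancel = solve-∀

det-shear : ∀ X Y n → det X (scale n X ⊕ Y) ≡ - det Y X
det-shear (x₁ , x₂) (y₁ , y₂) n = expand x₁ x₂ y₁ y₂ n
  where
  expand : ∀ x₁ x₂ y₁ y₂ n → x₁ * (n * x₂ + y₂) - x₂ * (n * x₁ + y₁) ≡ - (y₁ * x₂ - y₂ * x₁)
  expand = solve-∀

det-sumOK : ∀ κ S → det κ (sumOK S) ≡ sumℤ (map (det κ) S)
det-sumOK (p , q) [] = vanish p q
  where
  vanish : ∀ p q → p * 0ℤ - q * 0ℤ ≡ 0ℤ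
  vanish = solve-∀
det-sumOK κ@(p , q) (s@(x , y) ∷ S) = trans (linear p q x y (proj₁ (sumOK S)) (proj₂ (sumOK S)))
  (cong (λ x → det κ s + x) (det-sumOK κ S))
  where
  linear : ∀ p q x y x′ y′ → p * (y + y′) - q * (x + x′) ≡ (p * y - q * x) + (p * y′ - q * x′)
  linear = solve-∀

conj-⊕ : ∀ D a b → conj D (a ⊕ b) ≡ conj D a ⊕ conj D b
conj-⊕ D (x , y) (x′ , y′) with one-mod-4 D
... | true = cong₂ _,_ (shuffle x y x′ y′) (ℤP.neg-distrib-+ y y′)
  where
  shuffle : ∀ x y x′ y′ → x + x′ + (y + y′) ≡ x + y + (x′ + y′)
  shuffle = solve-∀
... | false = cong (x + x′ ,_) (ℤP.neg-distrib-+ y y′)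

conj-scale : ∀ D n a → conj D (scale n a) ≡ scale n (conj D a)
conj-scale D n (x , y) with one-mod-4 D
... | true = cong₂ _,_ (sym (ℤP.*-distribˡ-+ n x y)) (ℤP.neg-distribʳ-* n y)
... | false = cong (n * x ,_) (ℤP.neg-distribʳ-* n y)

conj-⊖ : ∀ D a b → conj D (a ⊖ b) ≡ conj D a ⊖ conj D b
conj-⊖ D (x , y) (x′ , y′) with one-mod-4 D
... | true = cong₂ _,_ (shuffle x y x′ y′) (ℤP.neg-distrib-+ y (- y′))
  where
  shuffle : ∀ x y x′ y′ → x - x′ + (y - y′) ≡ x + y - (x′ + y′)
  shuffle = solve-∀
... | false = cong (x - x′ ,_) (ℤP.neg-distrib-+ y (- y′))

conj-involutive : ∀ D z → conj D (conj D z) ≡ z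
conj-involutive D (x , y) with one-mod-4 D
... | true = cong₂ _,_ (cancel x y) (ℤP.neg-involutive y)
  where
  cancel : ∀ x y → x + y + - y ≡ x
  cancel = solve-∀
... | false = cong (x ,_) (ℤP.neg-involutive y)

det-conj : ∀ D a b → det (conj D a) (conj D b) ≡ - det a b
det-conj D (x , y) (x′ , y′) with one-mod-4 D
... | true = antisymmetric x y x′ y′
  where
  antisymmetric : ∀ x y x′ y′ → (x + y) * - y′ - - y * (x′ + y′) ≡ - (x * y′ - y * x′)
  antisymmetric = solve-∀
... | false = antisymmetric x y x′ y′
  where
  antisymmetric : ∀ x y x′ y′ → x * - y′ - - y * x′ ≡ - (x * y′ - y * x′)
  antisymmetric = solve-∀

-- Norm and total positivity

tcoordWith : Bool → OK → ℤ
tcoordWith c (x , y) = if c then + 2 * x + y else x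

tcoord : ℕ → OK → ℤ
tcoord D = tcoordWith (one-mod-4 D)

-- Writing z = (t + y √D) / c as in Defs, norm D z = c² N(z).
norm : ℕ → OK → ℤ
norm D z = tcoord D z * tcoord D z - + D * (proj₂ z * proj₂ z)

record TotallyPositive (D : ℕ) (z : OK) : Set where
  constructor totallyPositive
  field
    tcoord-pos : 0ℤ < tcoord D z
    norm-pos : 0ℤ < norm D z

open TotallyPositive

totPos⇒TotallyPositive : ∀ {D z} → T (totPos D z) → TotallyPositive D z
totPos⇒TotallyPositive {D} {z@(_ , y)} h with Equivalence.to T-∧ h
... | 0<t , Dy²<t² = totallyPositive (toWitness {a? = 0ℤ ℤ.<? tcoord D z} 0<t)
  (i<j⇒0<j-i (toWitness {a? = + D * (y * y) ℤ.<? tcoord D z * tcoord D z} Dy²<t²))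

TotallyPositive⇒totPos : ∀ {D z} → TotallyPositive D z → T (totPos D z)
TotallyPositive⇒totPos {D} {z@(_ , y)} (totallyPositive 0<t 0<n) = Equivalence.from T-∧
  ( fromWitness {a? = 0ℤ ℤ.<? tcoord D z} 0<t
  , fromWitness {a? = + D * (y * y) ℤ.<? tcoord D z * tcoord D z} (0<j-i⇒i<j 0<n))

tcoord-⊕ : ∀ D a b → tcoord D (a ⊕ b) ≡ tcoord D a + tcoord D b
tcoord-⊕ D (x , y) (x′ , y′) with one-mod-4 D
... | true = linear x y x′ y′
  where
  linear : ∀ x y x′ y′ → + 2 * (x + x′) + (y + y′) ≡ (+ 2 * x + y) + (+ 2 * x′ + y′)
  linear = solve-∀
... | false = refl

tcoord-scale : ∀ D n a → tcoord D (scale n a) ≡ n * tcoord D a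
tcoord-scale D n (x , y) with one-mod-4 D
... | true = linear n x y
  where
  linear : ∀ n x y → + 2 * (n * x) + n * y ≡ n * (+ 2 * x + y)
  linear = solve-∀
... | false = refl

tcoord-neg : ∀ D a → tcoord D (neg a) ≡ - tcoord D a
tcoord-neg D (x , y) with one-mod-4 D
... | true = linear x y
  where
  linear : ∀ x y → + 2 * (- x) + (- y) ≡ - (+ 2 * x + y)
  linear = solve-∀
... | false = refl

norm-neg : ∀ D z → norm D (neg z) ≡ norm D z
norm-neg D z rewrite tcoord-neg D z = even (+ D) (tcoord D z) (proj₂ z)
  where
  even : ∀ D t y → - t * - t - D * (- y * - y) ≡ t * t - D * (y * y)
  even = solve-∀

TotallyPositive-⊕ : ∀ {D a b} → TotallyPositive D a → TotallyPositive D b → TotallyPositive D (a ⊕ b)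
TotallyPositive-⊕ {D} {a} {b} (totallyPositive 0<t 0<n) (totallyPositive 0<t′ 0<n′) = totallyPositive
  (subst (0ℤ <_) (sym (tcoord-⊕ D a b)) (ℤP.+-mono-< 0<t 0<t′))
  (subst (0ℤ <_) (sym (trans (cong (λ s → s * s - + D * ((y + y′) * (y + y′))) (tcoord-⊕ D a b)) (sym (norm-sum (+ D) t y t′ y′))))
    (ℤP.+-mono-< (ℤP.+-mono-< 0<n 0<n′) (*-pos {+ 2} (+<+ (s≤s z≤n)) (i<j⇒0<j-i Dyy′<tt′))))
  where
  t t′ y y′ : ℤ
  t = tcoord D a
  t′ = tcoord D b
  y = proj₂ a
  y′ = proj₂ b
  -- N(a + b) = N(a) + N(b) + 2 (t t′ - D y y′), and t t′ > D y y′ by comparing squares.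
  Dy²<t² : + D * (y * y) < t * t
  Dy²<t² = 0<j-i⇒i<j 0<n
  Dy′²<t′² : + D * (y′ * y′) < t′ * t′
  Dy′²<t′² = 0<j-i⇒i<j 0<n′
  Dyy′<tt′ : + D * y * y′ < t * t′
  Dyy′<tt′ = square-<⇒< (*-pos 0<t 0<t′) (subst₂ _<_ (square-product (+ D) y y′) (interchange t t′) (begin-strict
    + D * (y * y) * (+ D * (y′ * y′)) ≤⟨ *-nonNeg-monoˡ-≤ (*-nonNeg {+ D} (+≤+ z≤n) (square-nonNeg y)) (ℤP.<⇒≤ Dy′²<t′²) ⟩
    + D * (y * y) * (t′ * t′)         <⟨ *-pos-monoʳ-< (*-pos 0<t′ 0<t′) Dy²<t² ⟩
    t * t * (t′ * t′)                 ∎))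
    where
    open ℤP.≤-Reasoning
    square-product : ∀ D y y′ → (D * (y * y)) * (D * (y′ * y′)) ≡ (D * y * y′) * (D * y * y′)
    square-product = solve-∀
    interchange : ∀ t t′ → (t * t) * (t′ * t′) ≡ (t * t′) * (t * t′)
    interchange = solve-∀
  norm-sum : ∀ D t y t′ y′ → (t * t - D * (y * y) + (t′ * t′ - D * (y′ * y′))) + + 2 * (t * t′ - D * y * y′) ≡
    (t + t′) * (t + t′) - D * ((y + y′) * (y + y′))
  norm-sum = solve-∀

tcoord-conj : ∀ D z → tcoord D (conj D z) ≡ tcoord D z
tcoord-conj D (x , y) with one-mod-4 D
... | true = cancel x y
  where
  cancel : ∀ x y → + 2 * (x + y) + - y ≡ + 2 * x + y
  cancel = solve-∀
... | false = refl

ycoord-conj : ∀ D z → proj₂ (conj D z) ≡ - proj₂ z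
ycoord-conj D (x , y) with one-mod-4 D
... | true = refl
... | false = refl

norm-conj : ∀ D z → norm D (conj D z) ≡ norm D z
norm-conj D z rewrite tcoord-conj D z | ycoord-conj D z = even (+ D) (tcoord D z) (proj₂ z)
  where
  even : ∀ D t y → t * t - D * (- y * - y) ≡ t * t - D * (y * y)
  even = solve-∀

TotallyPositive-conj : ∀ {D z} → TotallyPositive D z → TotallyPositive D (conj D z)
TotallyPositive-conj {D} {z} (totallyPositive 0<t 0<n) = totallyPositive
  (subst (0ℤ <_) (sym (tcoord-conj D z)) 0<t) (subst (0ℤ <_) (sym (norm-conj D z)) 0<n)

norm-⊖-comm : ∀ D X Y → norm D (X ⊖ Y) ≡ norm D (Y ⊖ X)
norm-⊖-comm D X Y = trans (cong (norm D) (⊖-anticomm X Y)) (norm-neg D (Y ⊖ X))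

norm-⊖-conj : ∀ D a b → norm D (conj D a ⊖ conj D b) ≡ norm D (a ⊖ b)
norm-⊖-conj D a b = trans (cong (norm D) (sym (conj-⊖ D a b))) (norm-conj D (a ⊖ b))

norm-scale-⊖-conj : ∀ D n a b → norm D (scale n (conj D a) ⊖ conj D b) ≡ norm D (scale n a ⊖ b)
norm-scale-⊖-conj D n a b = trans (cong (λ x → norm D (x ⊖ conj D b)) (sym (conj-scale D n a))) (norm-⊖-conj D (scale n a) b)

norm<0⇒y≢0 : ∀ {D k} → norm D k < 0ℤ → proj₂ k ≢ 0ℤ
norm<0⇒y≢0 {D} {k} Nk<0 y≡0 = ℤP.≤⇒≯ (subst (0ℤ ≤_) (sym (trans (cong (λ y → t * t - + D * (y * y)) y≡0) (at-zero (+ D) t)))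
  (square-nonNeg t)) Nk<0
  where
  t : ℤ
  t = tcoord D k
  at-zero : ∀ D t → t * t - D * (0ℤ * 0ℤ) ≡ t * t
  at-zero = solve-∀

norm<0⇒t²<Dy² : ∀ {D k} → norm D k < 0ℤ → tcoord D k * tcoord D k < + D * (proj₂ k * proj₂ k)
norm<0⇒t²<Dy² {D} {k} Nk<0 = 0<j-i⇒i<j (subst (0ℤ <_) (flip (+ D) (tcoord D k) (proj₂ k)) (ℤP.neg-mono-< Nk<0))
  where
  flip : ∀ D t y → - (t * t - D * (y * y)) ≡ D * (y * y) - t * t
  flip = solve-∀

-- The linear form vanishing at k, in (t, y)-coordinates.  If N(k) < 0 the
-- line through k misses the totally positive cone, so the form has constant
-- sign on the cone; the factor y_k makes that sign positive.
side : ℕ → OK → OK → ℤ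
side D k z = proj₂ k * (proj₂ k * tcoord D z - tcoord D k * proj₂ z)

side-pos : ∀ {D k z} → norm D k < 0ℤ → TotallyPositive D z → 0ℤ < side D k z
side-pos {D} {k} {z} Nk<0 (totallyPositive 0<t 0<n) =
  subst (0ℤ <_) (factor τ Y t y) (i<j⇒0<j-i τYy<YYt)
  where
  τ Y t y : ℤ
  τ = tcoord D k
  Y = proj₂ k
  t = tcoord D z
  y = proj₂ z
  0<Y² : 0ℤ < Y * Y
  0<Y² = square-pos (norm<0⇒y≢0 {D} {k} Nk<0)
  τYy<YYt : τ * Y * y < Y * Y * t
  τYy<YYt = square-<⇒< (*-pos 0<Y² 0<t) (begin-strict
    τ * Y * y * (τ * Y * y)              ≡⟨ regroup₁ τ Y y ⟩
    Y * Y * (y * y * (τ * τ))            ≤⟨ *-nonNeg-monoˡ-≤ (square-nonNeg Y)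
                                              (*-nonNeg-monoˡ-≤ (square-nonNeg y) (ℤP.<⇒≤ (norm<0⇒t²<Dy² {D} {k} Nk<0))) ⟩
    Y * Y * (y * y * (+ D * (Y * Y)))    ≡⟨ regroup₂ (+ D) Y y ⟩
    Y * Y * (Y * Y) * (+ D * (y * y))    <⟨ *-pos-monoˡ-< (*-pos 0<Y² 0<Y²) (0<j-i⇒i<j 0<n) ⟩
    Y * Y * (Y * Y) * (t * t)            ≡⟨ regroup₃ Y t ⟩
    Y * Y * t * (Y * Y * t)              ∎)
    where
    open ℤP.≤-Reasoning
    regroup₁ : ∀ τ Y y → τ * Y * y * (τ * Y * y) ≡ Y * Y * (y * y * (τ * τ))
    regroup₁ = solve-∀
    regroup₂ : ∀ D Y y → Y * Y * (y * y * (D * (Y * Y))) ≡ Y * Y * (Y * Y) * (D * (y * y))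
    regroup₂ = solve-∀
    regroup₃ : ∀ Y t → Y * Y * (Y * Y) * (t * t) ≡ Y * Y * t * (Y * Y * t)
    regroup₃ = solve-∀
  factor : ∀ τ Y t y → Y * Y * t - τ * Y * y ≡ Y * (Y * t - τ * y)
  factor = solve-∀

side-⊕ : ∀ D k a b → side D k (a ⊕ b) ≡ side D k a + side D k b
side-⊕ D k a b rewrite tcoord-⊕ D a b = linear (proj₂ k) (tcoord D k) (tcoord D a) (tcoord D b) (proj₂ a) (proj₂ b)
  where
  linear : ∀ Y T t t′ y y′ → Y * (Y * (t + t′) - T * (y + y′)) ≡ Y * (Y * t - T * y) + Y * (Y * t′ - T * y′)
  linear = solve-∀

side-scale : ∀ D k n a → side D k (scale n a) ≡ n * side D k a
side-scale D k n a rewrite tcoord-scale D n a = linear (proj₂ k) (tcoord D k) n (tcoord D a) (proj₂ a)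
  where
  linear : ∀ Y T n t y → Y * (Y * (n * t) - T * (n * y)) ≡ n * (Y * (Y * t - T * y))
  linear = solve-∀

side-self : ∀ D k → side D k k ≡ 0ℤ
side-self D k = vanish (proj₂ k) (tcoord D k)
  where
  vanish : ∀ Y T → Y * (Y * T - T * Y) ≡ 0ℤ
  vanish = solve-∀

polar : ℕ → OK → OK → ℤ
polar D X Z = + 2 * (tcoord D X * tcoord D Z - + D * (proj₂ X * proj₂ Z))

norm-line : ∀ D X Z r → norm D (X ⊕ scale r Z) ≡ norm D X + polar D X Z * r + norm D Z * (r * r)
norm-line D X Z r rewrite tcoord-⊕ D X (scale r Z) | tcoord-scale D r Z =
  expand (+ D) (tcoord D X) (proj₂ X) (tcoord D Z) (proj₂ Z) r
  where
  expand : ∀ D t y t′ y′ r → (t + r * t′) * (t + r * t′) - D * ((y + r * y′) * (y + r * y′)) ≡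
    (t * t - D * (y * y)) + + 2 * (t * t′ - D * (y * y′)) * r + (t′ * t′ - D * (y′ * y′)) * (r * r)
  expand = solve-∀

norm-pos-between : ∀ D X Z r u → 0ℤ ≤ r → r ≤ u → norm D Z ≤ 0ℤ →
  0ℤ < norm D X → 0ℤ < norm D (X ⊕ scale u Z) → 0ℤ < norm D (X ⊕ scale r Z)
norm-pos-between D X Z r u 0≤r r≤u NZ≤0 0<NX 0<at-u = subst (0ℤ <_) (sym (norm-line D X Z r))
  (quadratic-pos-between (norm D X) (polar D X Z) (norm D Z) r u 0≤r r≤u NZ≤0 0<NX (subst (0ℤ <_) (norm-line D X Z u) 0<at-u))

norm-neg-between : ∀ D X Z r u → 0ℤ ≤ r → r ≤ u → 0ℤ ≤ norm D Z →
  norm D X < 0ℤ → norm D (X ⊕ scale u Z) < 0ℤ → norm D (X ⊕ scale r Z) < 0ℤ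
norm-neg-between D X Z r u 0≤r r≤u 0≤NZ NX<0 at-u<0 = subst (_< 0ℤ) (sym (norm-line D X Z r))
  (quadratic-neg-between (norm D X) (polar D X Z) (norm D Z) r u 0≤r r≤u 0≤NZ NX<0 (subst (_< 0ℤ) (norm-line D X Z u) at-u<0))

-- Partitions as sorted lists

data _≤ₗ_ : OK → OK → Set where
  first< : ∀ {a b c d} → a < c → (a , b) ≤ₗ (c , d)
  second≤ : ∀ {a b d} → b ≤ d → (a , b) ≤ₗ (a , d)

≤lex⇒≤ₗ : ∀ x y → T (x ≤lex y) → x ≤ₗ y
≤lex⇒≤ₗ (a , b) (c , d) h with a ℤ.<? c | a ℤ.≟ c | b ℤ.≤? d
... | yes a<c | _ | _ = first< a<c
... | no _ | yes refl | yes b≤d = second≤ b≤d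

≤ₗ⇒≤lex : ∀ {x y} → x ≤ₗ y → T (x ≤lex y)
≤ₗ⇒≤lex {a , b} {c , d} (first< a<c) with a ℤ.<? c
... | yes _ = tt
... | no a≮c = ⊥-elim (a≮c a<c)
≤ₗ⇒≤lex {a , b} {.a , d} (second≤ b≤d) with a ℤ.<? a | a ℤ.≟ a | b ℤ.≤? d
... | yes _ | _ | _ = tt
... | no _ | yes _ | yes _ = tt
... | no _ | no a≢a | _ = a≢a refl
... | no _ | yes _ | no b≰d = b≰d b≤d

≤ₗ-refl : ∀ x → x ≤ₗ x
≤ₗ-refl (a , b) = second≤ ℤP.≤-refl

≤ₗ-trans : ∀ {x y z} → x ≤ₗ y → y ≤ₗ z → x ≤ₗ z
≤ₗ-trans (first< a<c) (first< c<e) = first< (ℤP.<-trans a<c c<e)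
≤ₗ-trans (first< a<c) (second≤ _) = first< a<c
≤ₗ-trans (second≤ _) (first< a<e) = first< a<e
≤ₗ-trans (second≤ b≤d) (second≤ d≤f) = second≤ (ℤP.≤-trans b≤d d≤f)

≤ₗ-antisym : ∀ {x y} → x ≤ₗ y → y ≤ₗ x → x ≡ y
≤ₗ-antisym (first< a<c) (first< c<a) = ⊥-elim (ℤP.<-asym a<c c<a)
≤ₗ-antisym (first< a<a) (second≤ _) = ⊥-elim (ℤP.<-irrefl refl a<a)
≤ₗ-antisym (second≤ _) (first< a<a) = ⊥-elim (ℤP.<-irrefl refl a<a)
≤ₗ-antisym (second≤ b≤d) (second≤ d≤b) = cong (_ ,_) (ℤP.≤-antisym b≤d d≤b)

≤ₗ-total : ∀ x y → x ≤ₗ y ⊎ y ≤ₗ x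
≤ₗ-total (a , b) (c , d) with ℤP.<-cmp a c
... | tri< a<c _ _ = inj₁ (first< a<c)
... | tri> _ _ c<a = inj₂ (first< c<a)
... | tri≈ _ refl _ with ℤP.≤-total b d
...   | inj₁ b≤d = inj₁ (second≤ b≤d)
...   | inj₂ d≤b = inj₂ (second≤ d≤b)

-- Partitions in Defs are sorted non-increasingly, i.e. along the reverse of ≤lex.
≥lex-decTotalOrder : DecTotalOrder 0ℓ 0ℓ 0ℓ
≥lex-decTotalOrder = record
  { Carrier = OK
  ; _≈_ = _≡_
  ; _≤_ = λ x y → T (y ≤lex x)
  ; isDecTotalOrder = record
    { isTotalOrder = record
      { isPartialOrder = record
        { isPreorder = record
          { isEquivalence = isEquivalence
          ; reflexive = λ { {x} refl → ≤ₗ⇒≤lex (≤ₗ-refl x) }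
          ; trans = λ {x} {y} {z} x≥y y≥z → ≤ₗ⇒≤lex (≤ₗ-trans (≤lex⇒≤ₗ z y y≥z) (≤lex⇒≤ₗ y x x≥y))
          }
        ; antisym = λ {x} {y} x≥y y≥x → ≤ₗ-antisym (≤lex⇒≤ₗ x y y≥x) (≤lex⇒≤ₗ y x x≥y)
        }
      ; total = λ x y → Sum.map ≤ₗ⇒≤lex ≤ₗ⇒≤lex (≤ₗ-total y x)
      }
    ; _≟_ = _≟ₒ_
    ; _≤?_ = λ x y → T? (y ≤lex x)
    }
  }

open DecTotalOrder ≥lex-decTotalOrder using (totalOrder)
open InsertionSort ≥lex-decTotalOrder using (sort)
open InsertionSortProperties ≥lex-decTotalOrder using (sort-↭; sort-↗)
open SortedList totalOrder using (Sorted)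

nonIncreasing⇒Sorted : ∀ l → T (nonIncreasing l) → Sorted l
nonIncreasing⇒Sorted [] _ = []
nonIncreasing⇒Sorted (x ∷ []) _ = [-]
nonIncreasing⇒Sorted (x ∷ y ∷ l) h =
  proj₁ (Equivalence.to T-∧ h) ∷ nonIncreasing⇒Sorted (y ∷ l) (proj₂ (Equivalence.to T-∧ h))

Sorted⇒nonIncreasing : ∀ {l} → Sorted l → T (nonIncreasing l)
Sorted⇒nonIncreasing [] = tt
Sorted⇒nonIncreasing [-] = tt
Sorted⇒nonIncreasing (y≤x ∷ rest) = Equivalence.from T-∧ (y≤x , Sorted⇒nonIncreasing rest)

Sorted-unique : ∀ {xs ys} → Sorted xs → Sorted ys → xs ↭ ys → xs ≡ ys
Sorted-unique xs↗ ys↗ xs↭ys = Pointwise-≡⇒≡ (SortedListProperties.↗↭↗⇒≋ totalOrder xs↗ ys↗ (↭⇒↭ₛ xs↭ys))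

sort-↭-≡ : ∀ {xs ys} → xs ↭ ys → sort xs ≡ sort ys
sort-↭-≡ {xs} {ys} xs↭ys =
  Sorted-unique (sort-↗ xs) (sort-↗ ys) (↭-trans (sort-↭ xs) (↭-trans xs↭ys (↭-sym (sort-↭ ys))))

==OK⇒≡ : ∀ a b → T (a ==OK b) → a ≡ b
==OK⇒≡ (x , y) (x′ , y′) h with Equivalence.to T-∧ h
... | x≡x′ , y≡y′ = cong₂ _,_ (toWitness {a? = x ℤ.≟ x′} x≡x′) (toWitness {a? = y ℤ.≟ y′} y≡y′)

==OK-refl : ∀ a → T (a ==OK a)
==OK-refl (x , y) = Equivalence.from T-∧ (fromWitness {a? = x ℤ.≟ x} refl , fromWitness {a? = y ℤ.≟ y} refl)

allTotPos⇒All : ∀ {D} l → T (allTotPos D l) → All (TotallyPositive D) l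
allTotPos⇒All [] _ = []
allTotPos⇒All (z ∷ l) h =
  totPos⇒TotallyPositive (proj₁ (Equivalence.to T-∧ h)) ∷ allTotPos⇒All l (proj₂ (Equivalence.to T-∧ h))

All⇒allTotPos : ∀ {D l} → All (TotallyPositive D) l → T (allTotPos D l)
All⇒allTotPos [] = tt
All⇒allTotPos (pos ∷ poss) = Equivalence.from T-∧ (TotallyPositive⇒totPos pos , All⇒allTotPos poss)

sumOK-↭ : ∀ {xs ys} → xs ↭ ys → sumOK xs ≡ sumOK ys
sumOK-↭ Perm.refl = refl
sumOK-↭ (prep x xs↭ys) = cong (x ⊕_) (sumOK-↭ xs↭ys)
sumOK-↭ (swap {xs} {ys} x y xs↭ys) = begin
  x ⊕ (y ⊕ sumOK xs) ≡⟨ ⊕-assoc x y (sumOK xs) ⟨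
  (x ⊕ y) ⊕ sumOK xs ≡⟨ cong₂ _⊕_ (⊕-comm x y) (sumOK-↭ xs↭ys) ⟩
  (y ⊕ x) ⊕ sumOK ys ≡⟨ ⊕-assoc y x (sumOK ys) ⟩
  y ⊕ (x ⊕ sumOK ys) ∎
  where open ≡-Reasoning
sumOK-↭ (Perm.trans xs↭ys ys↭zs) = trans (sumOK-↭ xs↭ys) (sumOK-↭ ys↭zs)

nonEmpty-↭ : ∀ {xs ys} → xs ↭ ys → T (nonEmpty ys) → T (nonEmpty xs)
nonEmpty-↭ {[]} {_ ∷ _} xs↭ys _ with ↭-length xs↭ys
... | ()
nonEmpty-↭ {_ ∷ _} _ _ = tt

record IsPartition (D : ℕ) (α : OK) (l : List OK) : Set where
  field
    nonempty : T (nonEmpty l)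
    parts-pos : All (TotallyPositive D) l
    sorted : Sorted l
    parts-sum : sumOK l ≡ α

isPartition⇒IsPartition : ∀ {D α} l → T (isPartition D α l) → IsPartition D α l
isPartition⇒IsPartition {D} {α} l h =
  let ne , h₁ = split (nonEmpty l) h
      pos , h₂ = split (allTotPos D l) h₁
      sorted , sum = split (nonIncreasing l) h₂
  in record
    { nonempty = ne
    ; parts-pos = allTotPos⇒All l pos
    ; sorted = nonIncreasing⇒Sorted l sorted
    ; parts-sum = ==OK⇒≡ (sumOK l) α sum
    }
  where
  split : ∀ a {b} → T (a ∧ b) → T a × T b
  split a = Equivalence.to T-∧

IsPartition⇒isPartition : ∀ {D α l} → IsPartition D α l → T (isPartition D α l)
IsPartition⇒isPartition {l = l} record { nonempty = ne ; parts-pos = pos ; sorted = sorted ; parts-sum = refl } =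
  from (ne , from (All⇒allTotPos pos , from (Sorted⇒nonIncreasing sorted , ==OK-refl (sumOK l))))
  where
  from : ∀ {a b} → T a × T b → T (a ∧ b)
  from = Equivalence.from T-∧

partition-≡ : ∀ {D α} {p q : Partition D α} → proj₁ p ≡ proj₁ q → p ≡ q
partition-≡ {p = l , h} {q = .l , h′} refl = cong (l ,_) (T-irrelevant h h′)

toPartition : ∀ {D α} l → T (nonEmpty l) → All (TotallyPositive D) l → sumOK l ≡ α → Partition D α
toPartition l ne pos sum = sort l , IsPartition⇒isPartition record
  { nonempty = nonEmpty-↭ (sort-↭ l) ne
  ; parts-pos = All-resp-↭ (↭-sym (sort-↭ l)) pos
  ; sorted = sort-↗ l
  ; parts-sum = trans (sumOK-↭ (sort-↭ l)) sum
  }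

toPartition-↭ : ∀ {D α} (p : Partition D α) {l} ne pos sum →
  proj₁ p ↭ l → p ≡ toPartition l ne pos sum
toPartition-↭ (l′ , h) {l} _ _ _ l′↭l = partition-≡
  (Sorted-unique (IsPartition.sorted (isPartition⇒IsPartition l′ h)) (sort-↗ l) (↭-trans l′↭l (↭-sym (sort-↭ l))))

-- Partitions of 3e in the coordinates of a unimodular basis (g, e)

_≟ₗ_ : (xs ys : List OK) → Dec (xs ≡ ys)
_≟ₗ_ = ListP.≡-dec _≟ₒ_

range : ℕ → List ℤ
range = applyUpTo (λ i → + suc i)

∈-range : ∀ {k x} → 0ℤ < x → x < + suc k → x ∈ range k
∈-range {x = + suc i} _ (+<+ (s≤s i<k)) = ∈-applyUpTo⁺ (λ i → + suc i) i<k
∈-range {x = + zero} (+<+ ()) _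

tuples : ℕ → List OK → List (List OK)
tuples zero C = [] ∷ []
tuples (suc k) C = cartesianProductWith _∷_ C (tuples k C)

∈-tuples : ∀ {C S} → All (_∈ C) S → S ∈ tuples (length S) C
∈-tuples [] = here refl
∈-tuples (s∈C ∷ S∈C) = ∈-cartesianProductWith⁺ _∷_ s∈C (∈-tuples S∈C)

candidate-partitions : List OK → List (List OK)
candidate-partitions C = ((0ℤ , + 3) ∷ []) ∷ tuples 2 C ++ tuples 3 C

module Coordinates (D : ℕ) (g e : OK) (unimodular : det g e * det g e ≡ 1ℤ) where

  φ : OK → OK
  φ (a , b) = scale a g ⊕ scale b e

  -- Cramer's rule; det g e = ±1 is its own inverse.
  ψ : OK → OK
  ψ z = (det g e * det z e , det g e * det g z)

  private
    g₁ g₂ e₁ e₂ ε : ℤ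
    g₁ = proj₁ g
    g₂ = proj₂ g
    e₁ = proj₁ e
    e₂ = proj₂ e
    ε = det g e

    ε²-cancel : ∀ x → ε * ε * x ≡ x
    ε²-cancel x = trans (cong (_* x) unimodular) (ℤP.*-identityˡ x)

  φ∘ψ : ∀ z → φ (ψ z) ≡ z
  φ∘ψ (z₁ , z₂) = cong₂ _,_
    (trans (cramer₁ ε z₁ z₂ g₁ g₂ e₁ e₂) (ε²-cancel z₁))
    (trans (cramer₂ ε z₁ z₂ g₁ g₂ e₁ e₂) (ε²-cancel z₂))
    where
    cramer₁ : ∀ ε z₁ z₂ g₁ g₂ e₁ e₂ →
      ε * (z₁ * e₂ - z₂ * e₁) * g₁ + ε * (g₁ * z₂ - g₂ * z₁) * e₁ ≡ ε * (g₁ * e₂ - g₂ * e₁) * z₁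
    cramer₁ = solve-∀
    cramer₂ : ∀ ε z₁ z₂ g₁ g₂ e₁ e₂ →
      ε * (z₁ * e₂ - z₂ * e₁) * g₂ + ε * (g₁ * z₂ - g₂ * z₁) * e₂ ≡ ε * (g₁ * e₂ - g₂ * e₁) * z₂
    cramer₂ = solve-∀

  ψ∘φ : ∀ p → ψ (φ p) ≡ p
  ψ∘φ (a , b) = cong₂ _,_
    (trans (expand₁ ε a b g₁ g₂ e₁ e₂) (ε²-cancel a))
    (trans (expand₂ ε a b g₁ g₂ e₁ e₂) (ε²-cancel b))
    where
    expand₁ : ∀ ε a b g₁ g₂ e₁ e₂ →
      ε * ((a * g₁ + b * e₁) * e₂ - (a * g₂ + b * e₂) * e₁) ≡ ε * (g₁ * e₂ - g₂ * e₁) * a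
    expand₁ = solve-∀
    expand₂ : ∀ ε a b g₁ g₂ e₁ e₂ →
      ε * (g₁ * (a * g₂ + b * e₂) - g₂ * (a * g₁ + b * e₁)) ≡ ε * (g₁ * e₂ - g₂ * e₁) * b
    expand₂ = solve-∀

  φ-⊕ : ∀ p q → φ (p ⊕ q) ≡ φ p ⊕ φ q
  φ-⊕ (a , b) (c , d) = cong₂ _,_ (linear a b c d g₁ e₁) (linear a b c d g₂ e₂)
    where
    linear : ∀ a b c d g e → (a + c) * g + (b + d) * e ≡ (a * g + b * e) + (c * g + d * e)
    linear = solve-∀

  φ-sumOK : ∀ L → φ (sumOK L) ≡ sumOK (map φ L)
  φ-sumOK [] = cong₂ _,_ (vanish g₁ e₁) (vanish g₂ e₂)
    where
    vanish : ∀ g e → 0ℤ * g + 0ℤ * e ≡ 0ℤ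
    vanish = solve-∀
  φ-sumOK (p ∷ L) = trans (φ-⊕ p (sumOK L)) (cong (φ p ⊕_) (φ-sumOK L))

  φ-neg : ∀ p → φ (neg p) ≡ neg (φ p)
  φ-neg (a , b) = cong₂ _,_ (linear a b g₁ e₁) (linear a b g₂ e₂)
    where
    linear : ∀ a b g e → - a * g + - b * e ≡ - (a * g + b * e)
    linear = solve-∀

  φ-⊖ : ∀ p q → φ (p ⊖ q) ≡ φ p ⊖ φ q
  φ-⊖ (a , b) (c , d) = cong₂ _,_ (linear a b c d g₁ e₁) (linear a b c d g₂ e₂)
    where
    linear : ∀ a b c d g e → (a - c) * g + (b - d) * e ≡ (a * g + b * e) - (c * g + d * e)
    linear = solve-∀

  φ-scale : ∀ n p → φ (scale n p) ≡ scale n (φ p)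
  φ-scale n (a , b) = cong₂ _,_ (linear n a b g₁ e₁) (linear n a b g₂ e₂)
    where
    linear : ∀ n a b g e → n * a * g + n * b * e ≡ n * (a * g + b * e)
    linear = solve-∀

  φ-1,0 : φ (1ℤ , 0ℤ) ≡ g
  φ-1,0 = cong₂ _,_ (unit g₁ e₁) (unit g₂ e₂)
    where
    unit : ∀ g e → 1ℤ * g + 0ℤ * e ≡ g
    unit = solve-∀

  φ-0,1 : φ (0ℤ , 1ℤ) ≡ e
  φ-0,1 = cong₂ _,_ (unit g₁ e₁) (unit g₂ e₂)
    where
    unit : ∀ g e → 0ℤ * g + 1ℤ * e ≡ e
    unit = solve-∀

  φ-relation : ∀ {f} w → g ⊕ f ≡ scale w e → φ (- 1ℤ , w) ≡ f
  φ-relation {f} w g+f≡we =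
    cong₂ _,_ (solve-for g₁ _ e₁ (cong proj₁ g+f≡we)) (solve-for g₂ _ e₂ (cong proj₂ g+f≡we))
    where
    solve-for : ∀ gᵢ fᵢ eᵢ → gᵢ + fᵢ ≡ w * eᵢ → - 1ℤ * gᵢ + w * eᵢ ≡ fᵢ
    solve-for gᵢ fᵢ eᵢ h = trans (cong (λ x → - 1ℤ * gᵢ + x) (sym h)) (cancel gᵢ fᵢ)
      where
      cancel : ∀ g f → - 1ℤ * g + (g + f) ≡ f
      cancel = solve-∀

  map-φ∘ψ : ∀ l → map φ (map ψ l) ≡ l
  map-φ∘ψ [] = refl
  map-φ∘ψ (z ∷ l) = cong₂ _∷_ (φ∘ψ z) (map-φ∘ψ l)

  map-ψ∘φ : ∀ L → map ψ (map φ L) ≡ L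
  map-ψ∘φ [] = refl
  map-ψ∘φ (p ∷ L) = cong₂ _∷_ (ψ∘φ p) (map-ψ∘φ L)

  φ-0,3 : φ (0ℤ , + 3) ≡ scale (+ 3) e
  φ-0,3 = cong₂ _,_ (triple g₁ e₁) (triple g₂ e₂)
    where
    triple : ∀ g e → 0ℤ * g + + 3 * e ≡ + 3 * e
    triple = solve-∀

  record Admissible (p : OK) : Set where
    constructor admissible
    field
      φ-pos : TotallyPositive D (φ p)

  open Admissible

  Admissible-⊕ : ∀ {p q} → Admissible p → Admissible q → Admissible (p ⊕ q)
  Admissible-⊕ {p} {q} (admissible pos-p) (admissible pos-q) =
    admissible (subst (TotallyPositive D) (sym (φ-⊕ p q)) (TotallyPositive-⊕ pos-p pos-q))

  -- det (p , q) is the form vanishing at the coordinates of κ = φ (p , q), so it is a multiple of side D κ.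
  det-pos : ∀ {p q s} → 0ℤ < p → norm D (φ (p , q)) < 0ℤ → TotallyPositive D e → Admissible s →
    0ℤ < det (p , q) s
  det-pos {p} {q} {s@(a , b)} 0<p Nκ<0 pos-e adm-s =
    *-pos-cancelˡ 0<ℓe (subst (0ℤ <_) key (*-pos 0<p (side-pos Nκ<0 (φ-pos adm-s))))
    where
    κ : OK
    κ = φ (p , q)
    ℓ : OK → ℤ
    ℓ = side D κ
    0<ℓe : 0ℤ < ℓ e
    0<ℓe = side-pos Nκ<0 pos-e
    ℓ-φ : ∀ a b → ℓ (φ (a , b)) ≡ a * ℓ g + b * ℓ e
    ℓ-φ a b = trans (side-⊕ D κ (scale a g) (scale b e)) (cong₂ _+_ (side-scale D κ a g) (side-scale D κ b e))
    ℓκ≡0 : p * ℓ g + q * ℓ e ≡ 0ℤ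
    ℓκ≡0 = trans (sym (ℓ-φ p q)) (side-self D (φ (p , q)))
    rearrange : ∀ p q a b ℓg ℓe → p * (a * ℓg + b * ℓe) ≡ a * (p * ℓg + q * ℓe) + ℓe * (p * b - q * a)
    rearrange = solve-∀
    key : p * ℓ (φ s) ≡ ℓ e * det (p , q) s
    key = begin
      p * ℓ (φ s)                                 ≡⟨ cong (p *_) (ℓ-φ a b) ⟩
      p * (a * ℓ g + b * ℓ e)                     ≡⟨ rearrange p q a b (ℓ g) (ℓ e) ⟩
      a * (p * ℓ g + q * ℓ e) + ℓ e * det (p , q) s ≡⟨ cong (λ x → a * x + ℓ e * det (p , q) s) ℓκ≡0 ⟩
      a * 0ℤ + ℓ e * det (p , q) s                ≡⟨ cong (_+ ℓ e * det (p , q) s) (ℤP.*-zeroʳ a) ⟩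
      0ℤ + ℓ e * det (p , q) s                    ≡⟨ ℤP.+-identityˡ _ ⟩
      ℓ e * det (p , q) s                         ∎
      where open ≡-Reasoning

  fromCoords : (L : List OK) → All Admissible L → sumOK L ≡ (0ℤ , + 3) → Partition D (scale (+ 3) e)
  fromCoords L@(_ ∷ _) adm sum =
    toPartition (map φ L) tt (All.map⁺ (All.map φ-pos adm)) (trans (sym (φ-sumOK L)) (trans (cong φ sum) φ-0,3))

  coords : Partition D (scale (+ 3) e) → List OK
  coords p = map ψ (proj₁ p)

  coords-admissible : ∀ p → All Admissible (coords p)
  coords-admissible (l , h) = All.map⁺ (All.map (admissible ∘ subst (TotallyPositive D) (sym (φ∘ψ _)))
    (IsPartition.parts-pos (isPartition⇒IsPartition l h)))

  coords-sum : ∀ p → sumOK (coords p) ≡ (0ℤ , + 3)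
  coords-sum (l , h) = begin
    sumOK (map ψ l)                 ≡⟨ ψ∘φ _ ⟨
    ψ (φ (sumOK (map ψ l)))         ≡⟨ cong ψ (φ-sumOK (map ψ l)) ⟩
    ψ (sumOK (map φ (map ψ l)))     ≡⟨ cong (ψ ∘ sumOK) (map-φ∘ψ l) ⟩
    ψ (sumOK l)                     ≡⟨ cong ψ (IsPartition.parts-sum (isPartition⇒IsPartition l h)) ⟩
    ψ (scale (+ 3) e)               ≡⟨ cong ψ φ-0,3 ⟨
    ψ (φ (0ℤ , + 3))                ≡⟨ ψ∘φ _ ⟩
    (0ℤ , + 3)                      ∎
    where open ≡-Reasoning

  coords-↭ : ∀ p {L} adm sum → coords p ↭ L → p ≡ fromCoords L adm sum
  coords-↭ p@(l , _) {L@(_ ∷ _)} adm sum coords↭L =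
    toPartition-↭ p _ _ _ (subst (_↭ map φ L) (map-φ∘ψ l) (Perm.map⁺ φ coords↭L))

  fromCoords-injective : ∀ {L L′} adm adm′ sum sum′ → fromCoords L adm sum ≡ fromCoords L′ adm′ sum′ →
    sort L ≡ sort L′
  fromCoords-injective {L@(_ ∷ _)} {L′@(_ ∷ _)} _ _ _ _ same = sort-↭-≡ (begin
    L                           ≡⟨ map-ψ∘φ L ⟨
    map ψ (map φ L)             ↭⟨ Perm.map⁺ ψ (sort-↭ (map φ L)) ⟨
    map ψ (sort (map φ L))      ≡⟨ cong (map ψ ∘ proj₁) same ⟩
    map ψ (sort (map φ L′))     ↭⟨ Perm.map⁺ ψ (sort-↭ (map φ L′)) ⟩
    map ψ (map φ L′)            ≡⟨ map-ψ∘φ L′ ⟩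
    L′                          ∎)
    where open Perm.PermutationReasoning

  Strip : OK → OK → Set
  Strip (p , q) s = 0ℤ < det (p , q) s × det (p , q) s < p * + 3

  strip? : ∀ κ s → Dec (Strip κ s)
  strip? (p , q) s = (0ℤ ℤ.<? det (p , q) s) ×-dec (det (p , q) s ℤ.<? p * + 3)

  Distinct : List (List OK) → Set
  Distinct table = ∀ i j → sort (lookup table i) ≡ sort (lookup table j) → i ≡ j

  distinct? : ∀ table → Dec (Distinct table)
  distinct? table = FinP.all? λ i → FinP.all? λ j →
    (sort (lookup table i) ≟ₗ sort (lookup table j)) →-dec (i FinP.≟ j)

  Listed : List (List OK) → List OK → Set
  Listed table S = sumOK S ≡ (0ℤ , + 3) → Any (λ L → sort S ≡ sort L) table

  listed? : ∀ table S → Dec (Listed table S)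
  listed? table S = (sumOK S ≟ₒ (0ℤ , + 3)) →-dec Any.any? (λ L → sort S ≟ₗ sort L) table

  record Enumeration : Set where
    field
      table : List (List OK)
      parts-admissible : All (All Admissible) table
      parts-sum : All (λ L → sumOK L ≡ (0ℤ , + 3)) table
      distinct : Distinct table

    partition : Fin (length table) → Partition D (scale (+ 3) e)
    partition i = fromCoords (lookup table i) (All.lookup parts-admissible (∈-lookup i)) (All.lookup parts-sum (∈-lookup i))

    partition-injective : ∀ {i j} → partition i ≡ partition j → i ≡ j
    partition-injective same = distinct _ _ (fromCoords-injective _ _ _ _ same)

    injection : Fin (length table) ↣ Partition D (scale (+ 3) e)
    injection = mk↣ partition-injective

  record Covering (E : Enumeration) : Set where
    open Enumeration E
    field
      candidates : List OK
      candidate : ∀ {S} → All Admissible S → sumOK S ≡ (0ℤ , + 3) → 2 ℕ.≤ length S → All (_∈ candidates) S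
      covered : All (Listed table) (candidate-partitions candidates)

  module _ (pos-e : TotallyPositive D e) (N[g-e]<0 : norm D (φ (1ℤ , - 1ℤ)) < 0ℤ) where

    det-pos-all : ∀ {p q S} → 0ℤ < p → norm D (φ (p , q)) < 0ℤ → All Admissible S → All (0ℤ <_) (map (det (p , q)) S)
    det-pos-all {p} {q} 0<p Nκ<0 adm = All.map⁺ (All.map (λ {s} → det-pos {p} {q} {s} 0<p Nκ<0 pos-e) adm)

    -- The values of det (p , q) on the parts are positive and add up to det (p , q) (0 , 3) = 3 p.
    part-bounds : ∀ {p q S} → 0ℤ < p → norm D (φ (p , q)) < 0ℤ → All Admissible S → sumOK S ≡ (0ℤ , + 3) →
      2 ℕ.≤ length S → All (Strip (p , q)) S
    part-bounds {p} {q} {S} 0<p Nκ<0 adm sum 2≤len = All.zip (All.map⁻ pos , All.map⁻ (subst (λ t → All (_< t) (map (det (p , q)) S))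
      total (<-sumℤ pos (subst (2 ℕ.≤_) (sym (ListP.length-map (det (p , q)) S)) 2≤len))))
      where
      pos : All (0ℤ <_) (map (det (p , q)) S)
      pos = det-pos-all {p} {q} 0<p Nκ<0 adm
      at-0,3 : ∀ p q → p * + 3 - q * 0ℤ ≡ p * + 3
      at-0,3 = solve-∀
      total : sumℤ (map (det (p , q)) S) ≡ p * + 3
      total = trans (sym (det-sumOK (p , q) S)) (trans (cong (det (p , q)) sum) (at-0,3 p q))

    length≤3 : ∀ {S} → All Admissible S → sumOK S ≡ (0ℤ , + 3) → length S ℕ.≤ 3
    length≤3 {S} adm sum = ℤP.drop‿+≤+ (begin
      + length S                          ≡⟨ cong +_ (ListP.length-map (det (1ℤ , - 1ℤ)) S) ⟨
      + length (map (det (1ℤ , - 1ℤ)) S)  ≤⟨ length≤sumℤ (det-pos-all {1ℤ} { - 1ℤ} (+<+ (s≤s z≤n)) N[g-e]<0 adm) ⟩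
      sumℤ (map (det (1ℤ , - 1ℤ)) S)      ≡⟨ det-sumOK (1ℤ , - 1ℤ) S ⟨
      det (1ℤ , - 1ℤ) (sumOK S)           ≡⟨ cong (det (1ℤ , - 1ℤ)) sum ⟩
      + 3                                 ∎)
      where open ℤP.≤-Reasoning

    ∈-candidate-partitions : ∀ {S C} → All Admissible S → sumOK S ≡ (0ℤ , + 3) →
      (2 ℕ.≤ length S → All (_∈ C) S) → S ∈ candidate-partitions C
    ∈-candidate-partitions {s ∷ []} _ sum _ = here (cong (_∷ []) (trans (sym (⊕-identityʳ s)) sum))
    ∈-candidate-partitions {_ ∷ _ ∷ []} _ _ in-C = there (∈-++⁺ˡ (∈-tuples (in-C (s≤s (s≤s z≤n)))))
    ∈-candidate-partitions {_ ∷ _ ∷ _ ∷ []} {C} _ _ in-C = there (∈-++⁺ʳ (tuples 2 C) (∈-tuples (in-C (s≤s (s≤s z≤n)))))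
    ∈-candidate-partitions {_ ∷ _ ∷ _ ∷ _ ∷ _} adm sum _ = ⊥-elim (ℕP.<⇒≱ (s≤s (s≤s (s≤s (s≤s z≤n)))) (length≤3 adm sum))

    bijection : ∀ {E} → Covering E → Fin (length (Enumeration.table E)) ⤖ Partition D (scale (+ 3) e)
    bijection {E} cov = mk⤖ (partition-injective , surjective)
      where
      open Enumeration E
      open Covering cov
      surjective : ∀ p → ∃ λ i → ∀ {j} → j ≡ i → partition j ≡ p
      surjective p = i , λ { refl → sym (coords-↭ p _ _ coords↭parts) }
        where
        listed : Any (λ L → sort (coords p) ≡ sort L) table
        listed = All.lookup covered
          (∈-candidate-partitions (coords-admissible p) (coords-sum p) (candidate (coords-admissible p) (coords-sum p))) (coords-sum p)
        i : Fin (length table)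
        i = Any.index listed
        coords↭parts : coords p ↭ lookup table i
        coords↭parts = ↭-trans (↭-sym (sort-↭ (coords p)))
          (subst (_↭ lookup table i) (sym (AnyP.lookup-index listed)) (sort-↭ (lookup table i)))

-- The configurations around β_j

-- g, e, f play the roles of β_{j-1}, β_j, β_{j+1}.
module Configurations (D : ℕ) (g e f : OK) (unimodular : det g e * det g e ≡ 1ℤ)
  (pos-g : TotallyPositive D g) (pos-e : TotallyPositive D e) (pos-f : TotallyPositive D f)
  (N[g-e]<0 : norm D (g ⊖ e) < 0ℤ) where

  open Coordinates D g e unimodular

  private
    norm<0-along : ∀ p {z} → φ p ≡ z → norm D z < 0ℤ → norm D (φ p) < 0ℤ
    norm<0-along p φp≡z Nz<0 = subst (λ z → norm D z < 0ℤ) (sym φp≡z) Nz<0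

    N[1,-1]<0 : norm D (φ (1ℤ , - 1ℤ)) < 0ℤ
    N[1,-1]<0 = norm<0-along (1ℤ , - 1ℤ) (trans (φ-⊖ (1ℤ , 0ℤ) (0ℤ , 1ℤ)) (cong₂ _⊖_ φ-1,0 φ-0,1)) N[g-e]<0

    adm-g : Admissible (1ℤ , 0ℤ)
    adm-g = admissible (subst (TotallyPositive D) (sym φ-1,0) pos-g)

    adm-e : Admissible (0ℤ , 1ℤ)
    adm-e = admissible (subst (TotallyPositive D) (sym φ-0,1) pos-e)

    adm-f : ∀ w → g ⊕ f ≡ scale w e → Admissible (- 1ℤ , w)
    adm-f w g+f≡we = admissible (subst (TotallyPositive D) (sym (φ-relation w g+f≡we)) pos-f)

    _+ᵃ_ : ∀ {p q} → Admissible p → Admissible q → Admissible (p ⊕ q)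
    _+ᵃ_ = Admissible-⊕

    N[f-e]-coords : ∀ w → g ⊕ f ≡ scale w e → norm D (f ⊖ e) < 0ℤ → norm D (φ (1ℤ , - (w - 1ℤ))) < 0ℤ
    N[f-e]-coords w g+f≡we N[f-e]<0 = norm<0-along (1ℤ , - (w - 1ℤ))
      (trans (φ-neg ((- 1ℤ , w) ⊖ (0ℤ , 1ℤ)))
        (cong neg (trans (φ-⊖ (- 1ℤ , w) (0ℤ , 1ℤ)) (cong₂ _⊖_ (φ-relation w g+f≡we) φ-0,1))))
      (subst (_< 0ℤ) (sym (norm-neg D (f ⊖ e))) N[f-e]<0)

    φ-2g-e : φ (+ 2 , - 1ℤ) ≡ scale (+ 2) g ⊖ e
    φ-2g-e = trans (φ-⊖ (scale (+ 2) (1ℤ , 0ℤ)) (0ℤ , 1ℤ))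
      (cong₂ _⊖_ (trans (φ-scale (+ 2) (1ℤ , 0ℤ)) (cong (scale (+ 2)) φ-1,0)) φ-0,1)

    φ-2f-e : g ⊕ f ≡ scale (+ 2) e → φ (- + 2 , + 3) ≡ scale (+ 2) f ⊖ e
    φ-2f-e g+f≡2e = trans (φ-⊖ (scale (+ 2) (- 1ℤ , + 2)) (0ℤ , 1ℤ))
      (cong₂ _⊖_ (trans (φ-scale (+ 2) (- 1ℤ , + 2)) (cong (scale (+ 2)) (φ-relation (+ 2) g+f≡2e))) φ-0,1)

    bounds : ∀ {p q S} → norm D (φ (p , q)) < 0ℤ → All Admissible S → sumOK S ≡ (0ℤ , + 3) →
      2 ℕ.≤ length S → {{ℤ.Positive p}} → All (Strip (p , q)) S
    bounds {p} {q} Nκ<0 adm sum 2≤len = part-bounds pos-e N[1,-1]<0 {p} {q} (ℤP.positive⁻¹ p) Nκ<0 adm sum 2≤len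

  partitions-v≥4 : List (List OK)
  partitions-v≥4 =
    ((0ℤ , + 3) ∷ []) ∷
    ((0ℤ , + 2) ∷ (0ℤ , 1ℤ) ∷ []) ∷
    ((0ℤ , 1ℤ) ∷ (0ℤ , 1ℤ) ∷ (0ℤ , 1ℤ) ∷ []) ∷ []

  partitions-v≥4-admissible : All (All Admissible) partitions-v≥4
  partitions-v≥4-admissible = (adm-2e +ᵃ adm-e ∷ []) ∷ (adm-2e ∷ adm-e ∷ []) ∷ (adm-e ∷ adm-e ∷ adm-e ∷ []) ∷ []
    where
    adm-2e : Admissible (0ℤ , + 2)
    adm-2e = adm-e +ᵃ adm-e

  partitions-v≡3 : List (List OK)
  partitions-v≡3 = partitions-v≥4 ++ ((1ℤ , 0ℤ) ∷ (- 1ℤ , + 3) ∷ []) ∷ []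

  partitions-v≡2 : List (List OK)
  partitions-v≡2 = partitions-v≥4 ++
    ((1ℤ , 0ℤ) ∷ (- 1ℤ , + 2) ∷ (0ℤ , 1ℤ) ∷ []) ∷
    ((1ℤ , 1ℤ) ∷ (- 1ℤ , + 2) ∷ []) ∷
    ((1ℤ , 0ℤ) ∷ (- 1ℤ , + 3) ∷ []) ∷ []

  partitions-v≡2-admissible : g ⊕ f ≡ scale (+ 2) e → All (All Admissible) partitions-v≡2
  partitions-v≡2-admissible g+f≡2e = All.++⁺ partitions-v≥4-admissible
    ( (adm-g ∷ adm-f (+ 2) g+f≡2e ∷ adm-e ∷ [])
    ∷ (adm-g +ᵃ adm-e ∷ adm-f (+ 2) g+f≡2e ∷ [])
    ∷ (adm-g ∷ adm-f (+ 2) g+f≡2e +ᵃ adm-e ∷ [])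
    ∷ [])

  partitions-v≡2-left : List (List OK)
  partitions-v≡2-left = partitions-v≡2 ++
    ((- 1ℤ , + 2) ∷ (- 1ℤ , + 2) ∷ (+ 2 , - 1ℤ) ∷ []) ∷
    ((- + 2 , + 4) ∷ (+ 2 , - 1ℤ) ∷ []) ∷ []

  partitions-v≡2-right : List (List OK)
  partitions-v≡2-right = partitions-v≡2 ++
    ((1ℤ , 0ℤ) ∷ (1ℤ , 0ℤ) ∷ (- + 2 , + 3) ∷ []) ∷
    ((+ 2 , 0ℤ) ∷ (- + 2 , + 3) ∷ []) ∷ []

  enumeration-v≥4 : Enumeration
  enumeration-v≥4 = record
    { table = partitions-v≥4
    ; parts-admissible = partitions-v≥4-admissible
    ; parts-sum = refl ∷ refl ∷ refl ∷ []
    ; distinct = from-yes (distinct? partitions-v≥4)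
    }

  enumeration-v≡3 : g ⊕ f ≡ scale (+ 3) e → Enumeration
  enumeration-v≡3 g+f≡3e = record
    { table = partitions-v≡3
    ; parts-admissible = All.++⁺ partitions-v≥4-admissible ((adm-g ∷ adm-f (+ 3) g+f≡3e ∷ []) ∷ [])
    ; parts-sum = refl ∷ refl ∷ refl ∷ refl ∷ []
    ; distinct = from-yes (distinct? partitions-v≡3)
    }

  enumeration-v≡2 : g ⊕ f ≡ scale (+ 2) e → Enumeration
  enumeration-v≡2 g+f≡2e = record
    { table = partitions-v≡2
    ; parts-admissible = partitions-v≡2-admissible g+f≡2e
    ; parts-sum = refl ∷ refl ∷ refl ∷ refl ∷ refl ∷ refl ∷ []
    ; distinct = from-yes (distinct? partitions-v≡2)
    }

  enumeration-v≡2-left : g ⊕ f ≡ scale (+ 2) e → TotallyPositive D (scale (+ 2) g ⊖ e) → Enumeration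
  enumeration-v≡2-left g+f≡2e pos-2g-e = record
    { table = partitions-v≡2-left
    ; parts-admissible = All.++⁺ (partitions-v≡2-admissible g+f≡2e)
        ((adm-f′ ∷ adm-f′ ∷ adm-2g-e ∷ []) ∷ (adm-f′ +ᵃ adm-f′ ∷ adm-2g-e ∷ []) ∷ [])
    ; parts-sum = refl ∷ refl ∷ refl ∷ refl ∷ refl ∷ refl ∷ refl ∷ refl ∷ []
    ; distinct = from-yes (distinct? partitions-v≡2-left)
    }
    where
    adm-f′ : Admissible (- 1ℤ , + 2)
    adm-f′ = adm-f (+ 2) g+f≡2e
    adm-2g-e : Admissible (+ 2 , - 1ℤ)
    adm-2g-e = admissible (subst (TotallyPositive D) (sym φ-2g-e) pos-2g-e)

  enumeration-v≡2-right : g ⊕ f ≡ scale (+ 2) e → TotallyPositive D (scale (+ 2) f ⊖ e) → Enumeration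
  enumeration-v≡2-right g+f≡2e pos-2f-e = record
    { table = partitions-v≡2-right
    ; parts-admissible = All.++⁺ (partitions-v≡2-admissible g+f≡2e)
        ((adm-g ∷ adm-g ∷ adm-2f-e ∷ []) ∷ (adm-g +ᵃ adm-g ∷ adm-2f-e ∷ []) ∷ [])
    ; parts-sum = refl ∷ refl ∷ refl ∷ refl ∷ refl ∷ refl ∷ refl ∷ refl ∷ []
    ; distinct = from-yes (distinct? partitions-v≡2-right)
    }
    where
    adm-2f-e : Admissible (- + 2 , + 3)
    adm-2f-e = admissible (subst (TotallyPositive D) (sym (φ-2f-e g+f≡2e)) pos-2f-e)

  covering-v≥4 : ∀ k → 2 ℕ.≤ k → g ⊕ f ≡ scale (+ (2 ℕ.+ k)) e → norm D (f ⊖ e) < 0ℤ → Covering enumeration-v≥4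
  covering-v≥4 k 2≤k g+f≡ve N[f-e]<0 = record
    { candidates = candidates
    ; candidate = λ adm sum 2≤len → All.map on-e-axis
        (All.zip (bounds {1ℤ} { - 1ℤ} N[1,-1]<0 adm sum 2≤len , bounds {1ℤ} {proj₂ κ} N[κ]<0 adm sum 2≤len))
    ; covered = from-yes (All.all? (listed? partitions-v≥4) (candidate-partitions candidates))
    }
    where
    candidates : List OK
    candidates = map (0ℤ ,_) (range 2)
    κ : OK
    κ = (1ℤ , - (+ (2 ℕ.+ k) - 1ℤ))
    N[κ]<0 : norm D (φ κ) < 0ℤ
    N[κ]<0 = N[f-e]-coords (+ (2 ℕ.+ k)) g+f≡ve N[f-e]<0
    -- a + b and (v - 1) a + b both lie in {1, 2}, so (v - 2) a ∈ {-1, 0, 1} forces a = 0.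
    on-e-axis : ∀ {s} → Strip (1ℤ , - 1ℤ) s × Strip κ s → s ∈ candidates
    on-e-axis {a , b} ((0<x , x<3) , (0<y , y<3)) = subst (_∈ candidates) (sym s≡) (∈-map⁺ (0ℤ ,_) (∈-range 0<x x<3))
      where
      y-x≡ka : det κ (a , b) - det (1ℤ , - 1ℤ) (a , b) ≡ + k * a
      y-x≡ka = trans (cong (λ v → det (1ℤ , - (v - 1ℤ)) (a , b) - det (1ℤ , - 1ℤ) (a , b)) (ℤP.pos-+ 2 k)) (difference (+ k) a b)
        where
        difference : ∀ k a b → (1ℤ * b - - (+ 2 + k - 1ℤ) * a) - (1ℤ * b - - 1ℤ * a) ≡ k * a
        difference = solve-∀
      a≡0 : a ≡ 0ℤ
      a≡0 = small-multiple≡0 2≤k (subst (- + 2 <_) y-x≡ka (proj₁ (difference-bounds 0<x x<3 0<y y<3)))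
        (subst (_< + 2) y-x≡ka (proj₂ (difference-bounds 0<x x<3 0<y y<3)))
      s≡ : (a , b) ≡ (0ℤ , det (1ℤ , - 1ℤ) (a , b))
      s≡ = cong₂ _,_ a≡0 (trans (sym (at-a≡0 b)) (cong (λ a → 1ℤ * b - - 1ℤ * a) (sym a≡0)))
        where
        at-a≡0 : ∀ b → 1ℤ * b - - 1ℤ * 0ℤ ≡ b
        at-a≡0 = solve-∀

  covering-v≡3 : (g+f≡3e : g ⊕ f ≡ scale (+ 3) e) → norm D (f ⊖ e) < 0ℤ → Covering (enumeration-v≡3 g+f≡3e)
  covering-v≡3 g+f≡3e N[f-e]<0 = record
    { candidates = candidates
    ; candidate = λ adm sum 2≤len → All.map solve
        (All.zip (bounds {1ℤ} { - 1ℤ} N[1,-1]<0 adm sum 2≤len , bounds {1ℤ} { - + 2} N[1,-2]<0 adm sum 2≤len))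
    ; covered = from-yes (All.all? (listed? partitions-v≡3) (candidate-partitions candidates))
    }
    where
    point : ℤ → ℤ → OK
    point x w = (w - x , + 2 * x - w)
    candidates : List OK
    candidates = cartesianProductWith point (range 2) (range 2)
    N[1,-2]<0 : norm D (φ (1ℤ , - + 2)) < 0ℤ
    N[1,-2]<0 = N[f-e]-coords (+ 3) g+f≡3e N[f-e]<0
    solve : ∀ {s} → Strip (1ℤ , - 1ℤ) s × Strip (1ℤ , - + 2) s → s ∈ candidates
    solve {a , b} ((0<x , x<3) , (0<w , w<3)) = subst (_∈ candidates) (cong₂ _,_ (invert₁ a b) (invert₂ a b))
      (∈-cartesianProductWith⁺ point (∈-range 0<x x<3) (∈-range 0<w w<3))
      where
      invert₁ : ∀ a b → (1ℤ * b - - + 2 * a) - (1ℤ * b - - 1ℤ * a) ≡ a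
      invert₁ = solve-∀
      invert₂ : ∀ a b → + 2 * (1ℤ * b - - 1ℤ * a) - (1ℤ * b - - + 2 * a) ≡ b
      invert₂ = solve-∀

  covering-v≡2 : (g+f≡2e : g ⊕ f ≡ scale (+ 2) e) → norm D (scale (+ 2) g ⊖ e) < 0ℤ → norm D (scale (+ 2) f ⊖ e) < 0ℤ →
    Covering (enumeration-v≡2 g+f≡2e)
  covering-v≡2 g+f≡2e N[2g-e]<0 N[2f-e]<0 = record
    { candidates = candidates
    ; candidate = λ adm sum 2≤len → All.map solve (All.zip
        ( bounds {1ℤ} { - 1ℤ} N[1,-1]<0 adm sum 2≤len
        , All.zip (bounds {+ 2} { - + 3} N[2,-3]<0 adm sum 2≤len , bounds {+ 2} { - 1ℤ} N[2,-1]<0 adm sum 2≤len)))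
    ; covered = from-yes (All.all? (listed? partitions-v≡2) (candidate-partitions candidates))
    }
    where
    point : ℤ → ℤ → OK
    point x w = (w - + 2 * x , + 3 * x - w)
    candidates : List OK
    candidates = filter (strip? (+ 2 , - 1ℤ)) (cartesianProductWith point (range 2) (range 5))
    N[2,-3]<0 : norm D (φ (+ 2 , - + 3)) < 0ℤ
    N[2,-3]<0 = norm<0-along (+ 2 , - + 3) (trans (φ-neg (- + 2 , + 3)) (cong neg (φ-2f-e g+f≡2e)))
      (subst (_< 0ℤ) (sym (norm-neg D (scale (+ 2) f ⊖ e))) N[2f-e]<0)
    N[2,-1]<0 : norm D (φ (+ 2 , - 1ℤ)) < 0ℤ
    N[2,-1]<0 = norm<0-along (+ 2 , - 1ℤ) φ-2g-e N[2g-e]<0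
    solve : ∀ {s} → Strip (1ℤ , - 1ℤ) s × Strip (+ 2 , - + 3) s × Strip (+ 2 , - 1ℤ) s → s ∈ candidates
    solve {a , b} ((0<x , x<3) , (0<w , w<6) , strip) = ∈-filter⁺ (strip? (+ 2 , - 1ℤ))
      (subst (_∈ cartesianProductWith point (range 2) (range 5)) (cong₂ _,_ (invert₁ a b) (invert₂ a b))
        (∈-cartesianProductWith⁺ point (∈-range 0<x x<3) (∈-range 0<w w<6)))
      strip
      where
      invert₁ : ∀ a b → (+ 2 * b - - + 3 * a) - + 2 * (1ℤ * b - - 1ℤ * a) ≡ a
      invert₁ = solve-∀
      invert₂ : ∀ a b → + 3 * (1ℤ * b - - 1ℤ * a) - (+ 2 * b - - + 3 * a) ≡ b
      invert₂ = solve-∀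

  count-v≥4 : ∀ k → 2 ℕ.≤ k → g ⊕ f ≡ scale (+ (2 ℕ.+ k)) e → norm D (f ⊖ e) < 0ℤ →
    Fin 3 ⤖ Partition D (scale (+ 3) e)
  count-v≥4 k 2≤k g+f≡ve N[f-e]<0 = bijection pos-e N[1,-1]<0 (covering-v≥4 k 2≤k g+f≡ve N[f-e]<0)

  count-v≡3 : g ⊕ f ≡ scale (+ 3) e → norm D (f ⊖ e) < 0ℤ → Fin 4 ⤖ Partition D (scale (+ 3) e)
  count-v≡3 g+f≡3e N[f-e]<0 = bijection pos-e N[1,-1]<0 (covering-v≡3 g+f≡3e N[f-e]<0)

  count-v≡2 : g ⊕ f ≡ scale (+ 2) e → norm D (scale (+ 2) g ⊖ e) < 0ℤ → norm D (scale (+ 2) f ⊖ e) < 0ℤ →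
    Fin 6 ⤖ Partition D (scale (+ 3) e)
  count-v≡2 g+f≡2e N[2g-e]<0 N[2f-e]<0 = bijection pos-e N[1,-1]<0 (covering-v≡2 g+f≡2e N[2g-e]<0 N[2f-e]<0)

  count-v≡2-left : g ⊕ f ≡ scale (+ 2) e → TotallyPositive D (scale (+ 2) g ⊖ e) → Fin 8 ↣ Partition D (scale (+ 3) e)
  count-v≡2-left g+f≡2e pos-2g-e = Enumeration.injection (enumeration-v≡2-left g+f≡2e pos-2g-e)

  count-v≡2-right : g ⊕ f ≡ scale (+ 2) e → TotallyPositive D (scale (+ 2) f ⊖ e) → Fin 8 ↣ Partition D (scale (+ 3) e)
  count-v≡2-right g+f≡2e pos-2f-e = Enumeration.injection (enumeration-v≡2-right g+f≡2e pos-2f-e)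

-- The continued fraction of ω_D

isqrt-spec : ∀ n → isqrt n ℕ.* isqrt n ℕ.≤ n × n ℕ.< suc (isqrt n) ℕ.* suc (isqrt n)
isqrt-spec zero = z≤n , s≤s z≤n
isqrt-spec (suc n) with (suc (isqrt n) ℕ.* suc (isqrt n)) ℕ.≤ᵇ suc n in eq | isqrt-spec n
... | true | _ , n<[s+1]² = ℕP.≤ᵇ⇒≤ _ _ (subst T (sym eq) tt) , ℕP.<-≤-trans (s≤s n<[s+1]²) (next-square (isqrt n))
  where
  next-square : ∀ s → suc (suc s ℕ.* suc s) ℕ.≤ suc (suc s) ℕ.* suc (suc s)
  next-square s = subst (suc (suc s ℕ.* suc s) ℕ.≤_) (sym (expand s)) (s≤s (ℕP.m≤m+n _ _))
    where
    expand : ∀ s → suc (suc s) ℕ.* suc (suc s) ≡ suc (suc s ℕ.* suc s ℕ.+ (s ℕ.+ s ℕ.+ 2))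
    expand = ℕSolver.solve-∀
... | false | s²≤n , _ = ℕP.≤-trans s²≤n (ℕP.n≤1+n n) , ℕP.≰⇒> (λ h → subst T eq (ℕP.≤⇒≤ᵇ h))

-- One step (P, Q) ↦ (P′, Q′) of the continued fraction algorithm for (P + √D) / Q,
-- with P + s = r + a Q the division of P + s = P + ⌊√D⌋ by Q and P′ = a Q - P.

reduced-P≤aQ : ∀ {P Q s a r} → 0ℤ ≤ r → r < Q → 1ℤ ≤ a → P ≤ s → P + s ≡ r + a * Q → P ≤ a * Q
reduced-P≤aQ {P} {Q} {s} {a} {r} 0≤r r<Q 1≤a P≤s division = ℤP.≮⇒≥ λ aQ<P → ℤP.<-asym (s<r aQ<P) (r<s aQ<P)
  where
  Q≤aQ : Q ≤ a * Q
  Q≤aQ = subst (_≤ a * Q) (ℤP.*-identityˡ Q) (ℤP.*-monoʳ-≤-nonNeg Q {{ℤ.nonNegative (ℤP.<⇒≤ (ℤP.≤-<-trans 0≤r r<Q))}} 1≤a)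
  r<s : a * Q < P → r < s
  r<s aQ<P = ℤP.<-≤-trans r<Q (ℤP.≤-trans Q≤aQ (ℤP.≤-trans (ℤP.<⇒≤ aQ<P) P≤s))
  rearrange : ∀ P s r aQ → P - aQ ≡ (P + s) - s - aQ
  rearrange = solve-∀
  cancel : ∀ r aQ s → r + aQ - s - aQ ≡ r - s
  cancel = solve-∀
  s<r : a * Q < P → s < r
  s<r aQ<P = 0<j-i⇒i<j (subst (0ℤ <_) (trans (rearrange P s r (a * Q)) (trans (cong (λ x → x - s - a * Q) division) (cancel r (a * Q) s)))
    (i<j⇒0<j-i aQ<P))

reduced-r+P′≡s : ∀ {P P′ Q s a r} → P + s ≡ r + a * Q → P′ + P ≡ a * Q → r + P′ ≡ s
reduced-r+P′≡s {P} {P′} {Q} {s} {a} {r} division P′+P≡aQ = begin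
  r + P′                      ≡⟨ rearrange r P′ (a * Q) ⟩
  (r + a * Q) - a * Q + P′    ≡⟨ cong₂ (λ x y → x - y + P′) (sym division) (sym P′+P≡aQ) ⟩
  (P + s) - (P′ + P) + P′     ≡⟨ cancel P s P′ ⟩
  s                           ∎
  where
  open ≡-Reasoning
  rearrange : ∀ r P′ aQ → r + P′ ≡ (r + aQ) - aQ + P′
  rearrange = solve-∀
  cancel : ∀ P s P′ → (P + s) - (P′ + P) + P′ ≡ s
  cancel = solve-∀

reduced-D : ∀ {D P P′ Q K a} → D ≡ P * P + Q * K → P′ + P ≡ a * Q → D ≡ P′ * P′ + Q * (K + a * (P - P′))
reduced-D {D} {P} {P′} {Q} {K} {a} D≡ P′+P≡aQ = begin
  D                                                           ≡⟨ D≡ ⟩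
  P * P + Q * K                                               ≡⟨ rearrange P P′ Q K a ⟩
  P′ * P′ + Q * (K + a * (P - P′)) + (P - P′) * ((P′ + P) - a * Q)
    ≡⟨ cong (λ x → P′ * P′ + Q * (K + a * (P - P′)) + (P - P′) * (x - a * Q)) P′+P≡aQ ⟩
  P′ * P′ + Q * (K + a * (P - P′)) + (P - P′) * (a * Q - a * Q)   ≡⟨ cancel P P′ Q K a ⟩
  P′ * P′ + Q * (K + a * (P - P′))                            ∎
  where
  open ≡-Reasoning
  rearrange : ∀ P P′ Q K a → P * P + Q * K ≡ P′ * P′ + Q * (K + a * (P - P′)) + (P - P′) * ((P′ + P) - a * Q)
  rearrange = solve-∀
  cancel : ∀ P P′ Q K a → P′ * P′ + Q * (K + a * (P - P′)) + (P - P′) * (a * Q - a * Q) ≡ P′ * P′ + Q * (K + a * (P - P′))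
  cancel = solve-∀

reduced-0<K′ : ∀ {D P′ Q K′ s} → 0ℤ < Q → 0ℤ ≤ P′ → P′ ≤ s → s * s < D → D ≡ P′ * P′ + Q * K′ → 0ℤ < K′
reduced-0<K′ {D} {P′} {Q} {K′} {s} 0<Q 0≤P′ P′≤s s²<D D≡ = *-pos-cancelˡ 0<Q
  (subst (0ℤ <_) (trans (cong (_- P′ * P′) D≡) (cancel (P′ * P′) (Q * K′))) (i<j⇒0<j-i P′²<D))
  where
  cancel : ∀ x y → x + y - x ≡ y
  cancel = solve-∀
  P′²<D : P′ * P′ < D
  P′²<D = ℤP.≤-<-trans (ℤP.≤-trans (*-nonNeg-monoˡ-≤ 0≤P′ P′≤s)
    (ℤP.*-monoʳ-≤-nonNeg s {{ℤ.nonNegative (ℤP.≤-trans 0≤P′ P′≤s)}} P′≤s)) s²<D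

reduced-K′≤ : ∀ {D P′ Q K′ s r} → 0ℤ ≤ r → r < Q → 0ℤ ≤ K′ → r + P′ ≡ s → D ≡ P′ * P′ + Q * K′ →
  D < (s + 1ℤ) * (s + 1ℤ) → K′ ≤ P′ + s
reduced-K′≤ {D} {P′} {Q} {K′} {s} {r} 0≤r r<Q 0≤K′ r+P′≡s D≡ D<[s+1]² = ℤP.≮⇒≥ too-big
  where
  0≤r+1 : 0ℤ ≤ r + 1ℤ
  0≤r+1 = ℤP.+-mono-≤ 0≤r (+≤+ z≤n)
  square : ∀ r P′ s → r + P′ ≡ s → P′ * P′ + (r + 1ℤ) * (P′ + s + 1ℤ) ≡ (s + 1ℤ) * (s + 1ℤ)
  square r P′ s refl = expand r P′
    where
    expand : ∀ r P′ → P′ * P′ + (r + 1ℤ) * (P′ + (r + P′) + 1ℤ) ≡ (r + P′ + 1ℤ) * (r + P′ + 1ℤ)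
    expand = solve-∀
  too-big : ¬ (P′ + s < K′)
  too-big P′+s<K′ = ℤP.<-irrefl refl (ℤP.<-≤-trans D<[s+1]² (begin
    (s + 1ℤ) * (s + 1ℤ)                       ≡⟨ square r P′ s r+P′≡s ⟨
    P′ * P′ + (r + 1ℤ) * (P′ + s + 1ℤ)        ≤⟨ ℤP.+-monoʳ-≤ (P′ * P′) (ℤP.≤-trans
                                                   (*-nonNeg-monoˡ-≤ 0≤r+1 (i<j⇒i+1≤j P′+s<K′))
                                                   (ℤP.*-monoʳ-≤-nonNeg K′ {{ℤ.nonNegative 0≤K′}} (i<j⇒i+1≤j r<Q))) ⟩
    P′ * P′ + Q * K′                          ≡⟨ D≡ ⟨
    D                                         ∎))
    where open ℤP.≤-Reasoning

-- p + q ξ_D in the basis (1 , ω_D); the flag says whether D ≡ 1 (mod 4), i.e. whether ξ_D = ω_D - 1.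
fromξ : Bool → ℕ → ℕ → OK
fromξ c p q = if c then (+ p - + q , + q) else (+ p , + q)

-- (P₀ , Q₀) with ω_D = (P₀ + √D) / Q₀.
initial-state : Bool → ℕ × ℕ
initial-state c = if c then (1 , 2) else (0 , 1)

initial-Q≡1+P : ∀ c → proj₂ (initial-state c) ≡ suc (proj₁ (initial-state c))
initial-Q≡1+P true = refl
initial-Q≡1+P false = refl

tcoordWith-fromξ : ∀ c p q → tcoordWith c (fromξ c p q) ≡
  + proj₂ (initial-state c) * + p - + proj₁ (initial-state c) * + q
tcoordWith-fromξ true p q = linear (+ p) (+ q)
  where
  linear : ∀ p q → + 2 * (p - q) + q ≡ + 2 * p - + 1 * q
  linear = solve-∀
tcoordWith-fromξ false p q = linear (+ p) (+ q)
  where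
  linear : ∀ p q → p ≡ + 1 * p - + 0 * q
  linear = solve-∀

ycoord-fromξ : ∀ c p q → proj₂ (fromξ c p q) ≡ + q
ycoord-fromξ true p q = refl
ycoord-fromξ false p q = refl

fromξ-rec : ∀ c u p₁ p₀ q₁ q₀ →
  fromξ c (u ℕ.* p₁ ℕ.+ p₀) (u ℕ.* q₁ ℕ.+ q₀) ≡ scale (+ u) (fromξ c p₁ q₁) ⊕ fromξ c p₀ q₀
fromξ-rec c u p₁ p₀ q₁ q₀ with cast p₁ p₀ | cast q₁ q₀
  where
  cast : ∀ m n → + (u ℕ.* m ℕ.+ n) ≡ + u * + m + + n
  cast m n = trans (ℤP.pos-+ (u ℕ.* m) n) (cong (_+ + n) (ℤP.pos-* u m))
fromξ-rec true u p₁ p₀ q₁ q₀ | p-cast | q-cast =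
  cong₂ _,_ (trans (cong₂ _-_ p-cast q-cast) (linear (+ u) (+ p₁) (+ p₀) (+ q₁) (+ q₀))) q-cast
  where
  linear : ∀ u p₁ p₀ q₁ q₀ → u * p₁ + p₀ - (u * q₁ + q₀) ≡ u * (p₁ - q₁) + (p₀ - q₀)
  linear = solve-∀
fromξ-rec false u p₁ p₀ q₁ q₀ | p-cast | q-cast = cong₂ _,_ p-cast q-cast

det-fromξ-initial : ∀ c a → det (fromξ c 1 0) (fromξ c a 1) ≡ 1ℤ
det-fromξ-initial true a = unit (+ a)
  where
  unit : ∀ a → (+ 1 - + 0) * + 1 - + 0 * (a - + 1) ≡ 1ℤ
  unit = solve-∀
det-fromξ-initial false a = unit (+ a)
  where
  unit : ∀ a → + 1 * + 1 - + 0 * a ≡ 1ℤ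
  unit = solve-∀

-- conj D = conjWith (one-mod-4 D), with the flag exposed for case analysis.
conjWith : Bool → OK → OK
conjWith c (x , y) = if c then (x + y , - y) else (x , - y)

-- Tr(a + ξ_D) = u₀ for a = ⌊ω_D⌋.
trace-fromξ : ∀ c a → 1 ℕ.≤ a →
  conjWith c (fromξ c a 1) ⊕ fromξ c a 1 ≡ scale (+ (if c then 2 ℕ.* a ∸ 1 else 2 ℕ.* a)) (fromξ c 1 0)
trace-fromξ true (suc b) _ = cong₂ _,_ (trans (trace (+ b)) (cong (_* (+ 1 - + 0)) (sym 2a-1≡))) (vanish (+ (2 ℕ.* suc b ∸ 1)))
  where
  trace : ∀ b → (+ 1 + b - + 1 + + 1) + (+ 1 + b - + 1) ≡ (+ 1 + + 2 * b) * (+ 1 - + 0)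
  trace = solve-∀
  vanish : ∀ w → - + 1 + + 1 ≡ w * + 0
  vanish = solve-∀
  2a-1≡ : + (2 ℕ.* suc b ∸ 1) ≡ + 1 + + 2 * + b
  2a-1≡ = trans (cong +_ (ℕP.+-suc b (b ℕ.+ 0))) (trans (ℤP.pos-+ 1 (2 ℕ.* b)) (cong (λ x → + 1 + x) (ℤP.pos-* 2 b)))
trace-fromξ false a _ = cong₂ _,_ (trans (trace (+ a)) (cong (_* + 1) (sym (ℤP.pos-* 2 a)))) (vanish (+ (2 ℕ.* a)))
  where
  trace : ∀ a → a + a ≡ + 2 * a * + 1
  trace = solve-∀
  vanish : ∀ w → - + 1 + + 1 ≡ w * + 0
  vanish = solve-∀

conjWith-one : ∀ c → conjWith c (fromξ c 1 0) ≡ fromξ c 1 0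
conjWith-one true = refl
conjWith-one false = refl

module ContinuedFraction (D : ℕ) (2≤D : 2 ℕ.≤ D) (sqf : Squarefree D) where

  s : ℕ
  s = isqrt D

  D-not-square : s ℕ.* s ≢ D
  D-not-square s²≡D = ℕP.<⇒≱ (s≤s (s≤s z≤n)) (subst (2 ℕ.≤_) D≡1 2≤D)
    where
    s≡1 : s ≡ 1
    s≡1 = sqf s (divides 1 (trans (sym s²≡D) (sym (ℕP.*-identityˡ (s ℕ.* s)))))
    D≡1 : D ≡ 1
    D≡1 = trans (sym s²≡D) (cong (λ x → x ℕ.* x) s≡1)

  s²<D : s ℕ.* s ℕ.< D
  s²<D = ℕP.≤∧≢⇒< (proj₁ (isqrt-spec D)) D-not-square

  D<[s+1]² : D ℕ.< suc s ℕ.* suc s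
  D<[s+1]² = proj₂ (isqrt-spec D)

  1≤s : 1 ℕ.≤ s
  1≤s with s | D<[s+1]²
  ... | zero | s≤s D≤0 = ⊥-elim (ℕP.<⇒≱ (s≤s z≤n) (ℕP.≤-trans (ℕP.≤-trans (s≤s z≤n) 2≤D) D≤0))
  ... | suc _ | _ = s≤s z≤n

  -- The complete quotients of ω_D are (P + √D) / Q; cfState D n = (P_n , Q_n).
  record Reduced (P Q : ℕ) : Set where
    field
      1≤Q : 1 ℕ.≤ Q
      P≤s : P ℕ.≤ s
      Q≤P+s : Q ℕ.≤ P ℕ.+ s
      K : ℕ
      D≡P²+QK : D ≡ P ℕ.* P ℕ.+ Q ℕ.* K

  quotient : ℕ → ℕ → ℕ
  quotient P Q = div' (P ℕ.+ s) Q

  next-P : ℕ → ℕ → ℕ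
  next-P P Q = quotient P Q ℕ.* Q ∸ P

  next-Q : ℕ → ℕ → ℕ
  next-Q P Q = div' (D ∸ next-P P Q ℕ.* next-P P Q) Q

  record Step (P Q : ℕ) : Set where
    field
      reduced : Reduced (next-P P Q) (next-Q P Q)
      P′+P≡aQ : next-P P Q ℕ.+ P ≡ quotient P Q ℕ.* Q
      QQ′+P′²≡D : Q ℕ.* next-Q P Q ℕ.+ next-P P Q ℕ.* next-P P Q ≡ D
      1≤a : 1 ℕ.≤ quotient P Q

  cast-square-sum : ∀ a b c d → + (a ℕ.* b ℕ.+ c ℕ.* d) ≡ + a * + b + + c * + d
  cast-square-sum a b c d = trans (ℤP.pos-+ (a ℕ.* b) (c ℕ.* d)) (cong₂ _+_ (ℤP.pos-* a b) (ℤP.pos-* c d))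

  D<[s+1]²ℤ : + D < (+ s + 1ℤ) * (+ s + 1ℤ)
  D<[s+1]²ℤ = subst (+ D <_) (trans (ℤP.pos-* (suc s) (suc s)) (cong (λ x → x * x) (trans (cong +_ (ℕP.+-comm 1 s)) (ℤP.pos-+ s 1))))
    (+<+ D<[s+1]²)

  module StepFacts (P q : ℕ) (red : Reduced P (suc q)) where
    open Reduced red
    Q a r : ℕ
    Q = suc q
    a = (P ℕ.+ s) / Q
    r = (P ℕ.+ s) % Q
    1≤a : 1 ℕ.≤ a
    1≤a = m≥n⇒m/n>0 Q≤P+s
    division : + P + + s ≡ + r + + a * + Q
    division = trans (sym (ℤP.pos-+ P s)) (trans (cong +_ (m≡m%n+[m/n]*n (P ℕ.+ s) Q))
      (trans (ℤP.pos-+ r (a ℕ.* Q)) (cong (λ x → + r + x) (ℤP.pos-* a Q))))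
    P≤aQ : P ℕ.≤ a ℕ.* Q
    P≤aQ = ℤP.drop‿+≤+ (subst (+ P ≤_) (sym (ℤP.pos-* a Q))
      (reduced-P≤aQ (+≤+ z≤n) (+<+ (m%n<n (P ℕ.+ s) Q)) (+≤+ 1≤a) (+≤+ P≤s) division))
    P′ : ℕ
    P′ = a ℕ.* Q ∸ P
    P′+P≡aQ : P′ ℕ.+ P ≡ a ℕ.* Q
    P′+P≡aQ = ℕP.m∸n+n≡m P≤aQ
    P′+P≡aQℤ : + P′ + + P ≡ + a * + Q
    P′+P≡aQℤ = trans (sym (ℤP.pos-+ P′ P)) (trans (cong +_ P′+P≡aQ) (ℤP.pos-* a Q))
    r+P′≡sℤ : + r + + P′ ≡ + s
    r+P′≡sℤ = reduced-r+P′≡s {+ P} {+ P′} {+ Q} {+ s} {+ a} {+ r} division P′+P≡aQℤ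
    P′≤s : P′ ℕ.≤ s
    P′≤s = subst (P′ ℕ.≤_) (ℤP.+-injective (trans (ℤP.pos-+ r P′) r+P′≡sℤ)) (ℕP.m≤n+m P′ r)
    K′ℤ : ℤ
    K′ℤ = + K + + a * (+ P - + P′)
    D≡P′²+QK′ℤ : + D ≡ + P′ * + P′ + + Q * K′ℤ
    D≡P′²+QK′ℤ = reduced-D {+ D} {+ P} {+ P′} {+ Q} {+ K} {+ a} (trans (cong +_ D≡P²+QK) (cast-square-sum P P Q K)) P′+P≡aQℤ
    0<K′ : 0ℤ < K′ℤ
    0<K′ = reduced-0<K′ {P′ = + P′} {Q = + Q} (+<+ (s≤s z≤n)) (+≤+ z≤n) (+≤+ P′≤s)
      (subst (_< + D) (ℤP.pos-* s s) (+<+ s²<D)) D≡P′²+QK′ℤ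
    K′ : ℕ
    K′ = ℤ.∣ K′ℤ ∣
    +K′≡K′ : + K′ ≡ K′ℤ
    +K′≡K′ = ℤP.0≤i⇒+∣i∣≡i (ℤP.<⇒≤ 0<K′)
    D≡P′²+QK′ : D ≡ P′ ℕ.* P′ ℕ.+ Q ℕ.* K′
    D≡P′²+QK′ = ℤP.+-injective (trans D≡P′²+QK′ℤ
      (sym (trans (cast-square-sum P′ P′ Q K′) (cong (λ x → + P′ * + P′ + + Q * x) +K′≡K′))))
    next-Q≡K′ : next-Q P Q ≡ K′
    next-Q≡K′ = begin
      (D ∸ P′ ℕ.* P′) / Q                          ≡⟨ cong (λ x → (x ∸ P′ ℕ.* P′) / Q) D≡P′²+QK′ ⟩
      (P′ ℕ.* P′ ℕ.+ Q ℕ.* K′ ∸ P′ ℕ.* P′) / Q     ≡⟨ cong (_/ Q) (ℕP.m+n∸m≡n (P′ ℕ.* P′) (Q ℕ.* K′)) ⟩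
      (Q ℕ.* K′) / Q                               ≡⟨ cong (_/ Q) (ℕP.*-comm Q K′) ⟩
      (K′ ℕ.* Q) / Q                               ≡⟨ m*n/n≡m K′ Q ⟩
      K′                                           ∎
      where open ≡-Reasoning

  step : ∀ {P Q} → Reduced P Q → Step P Q
  step {P} {zero} red with Reduced.1≤Q red
  ... | ()
  step {P} {suc q} red = record
    { reduced = record
      { 1≤Q = subst (1 ℕ.≤_) (sym next-Q≡K′) (ℤP.drop‿+≤+ (subst (1ℤ ≤_) (sym +K′≡K′) (0<i⇒1≤i 0<K′)))
      ; P≤s = P′≤s
      ; Q≤P+s = subst (ℕ._≤ P′ ℕ.+ s) (sym next-Q≡K′)
          (ℤP.drop‿+≤+ (subst₂ _≤_ (sym +K′≡K′) (sym (ℤP.pos-+ P′ s))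
            (reduced-K′≤ {P′ = + P′} {r = + r} (+≤+ z≤n) (+<+ (m%n<n (P ℕ.+ s) Q)) (ℤP.<⇒≤ 0<K′)
              r+P′≡sℤ D≡P′²+QK′ℤ D<[s+1]²ℤ)))
      ; K = Q
      ; D≡P²+QK = trans D≡P′²+QK′ (cong (P′ ℕ.* P′ ℕ.+_) (trans (ℕP.*-comm Q K′) (cong (ℕ._* Q) (sym next-Q≡K′))))
      }
    ; P′+P≡aQ = P′+P≡aQ
    ; QQ′+P′²≡D = trans (ℕP.+-comm (Q ℕ.* next-Q P Q) (P′ ℕ.* P′))
        (trans (cong (λ x → P′ ℕ.* P′ ℕ.+ Q ℕ.* x) next-Q≡K′) (sym D≡P′²+QK′))
    ; 1≤a = 1≤a
    }
    where open StepFacts P q red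

  Pₙ Qₙ : ℕ → ℕ
  Pₙ n = proj₁ (cfState D n)
  Qₙ n = proj₂ (cfState D n)

  reduced-initial : Reduced (Pₙ 0) (Qₙ 0)
  reduced-initial with one-mod-4 D in D≡1[4]
  ... | true = record { 1≤Q = s≤s z≤n ; P≤s = 1≤s ; Q≤P+s = s≤s 1≤s ; K = 2 ℕ.* (D / 4) ; D≡P²+QK = D≡ }
    where
    D≡ : D ≡ 1 ℕ.* 1 ℕ.+ 2 ℕ.* (2 ℕ.* (D / 4))
    D≡ = trans (m≡m%n+[m/n]*n D 4) (trans (cong (ℕ._+ (D / 4) ℕ.* 4) (ℕP.≡ᵇ⇒≡ (D % 4) 1 (subst T (sym D≡1[4]) tt)))
      (regroup (D / 4)))
      where
      regroup : ∀ k → 1 ℕ.+ k ℕ.* 4 ≡ 1 ℕ.* 1 ℕ.+ 2 ℕ.* (2 ℕ.* k)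
      regroup = ℕSolver.solve-∀
  ... | false = record { 1≤Q = s≤s z≤n ; P≤s = z≤n ; Q≤P+s = 1≤s ; K = D ; D≡P²+QK = sym (ℕP.*-identityˡ D) }

  reduced : ∀ n → Reduced (Pₙ n) (Qₙ n)
  reduced zero = reduced-initial
  reduced (suc n) = Step.reduced (step (reduced n))

  step-at : ∀ n → Step (Pₙ n) (Qₙ n)
  step-at n = step (reduced n)

  1≤pq : ∀ n → 1 ℕ.≤ pq D n
  1≤pq n = Step.1≤a (step-at n)

  1≤u : ∀ n → 1 ℕ.≤ u D n
  1≤u zero with one-mod-4 D | pq D 0 | 1≤pq 0
  ... | true | suc a | _ = ℕP.≤-trans (s≤s z≤n) (ℕP.m≤n+m (suc (a ℕ.+ 0)) a)
  ... | false | suc a | _ = s≤s z≤n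
  1≤u (suc n) = 1≤pq (suc n)

  Pℤ Qℤ Aℤ : ℕ → ℤ
  Pℤ k = + Pₙ k
  Qℤ k = + Qₙ k
  Aℤ k = + pq D k

  0<Qℤ : ∀ k → 0ℤ < Qℤ k
  0<Qℤ k = +<+ (Reduced.1≤Q (reduced k))

  P-step : ∀ k → Pℤ (suc k) + Pℤ k - Aℤ k * Qℤ k ≡ 0ℤ
  P-step k = trans (cong (_- Aℤ k * Qℤ k) (trans (sym (ℤP.pos-+ (Pₙ (suc k)) (Pₙ k)))
    (trans (cong +_ (Step.P′+P≡aQ (step-at k))) (ℤP.pos-* (pq D k) (Qₙ k))))) (ℤP.+-inverseʳ (Aℤ k * Qℤ k))

  Q-step : ∀ k → Qℤ k * Qℤ (suc k) + Pℤ (suc k) * Pℤ (suc k) - + D ≡ 0ℤ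
  Q-step k = trans (cong (_- + D) (trans (sym (cast-square-sum (Qₙ k) (Qₙ (suc k)) (Pₙ (suc k)) (Pₙ (suc k))))
    (cong +_ (Step.QQ′+P′²≡D (step-at k))))) (ℤP.+-inverseʳ (+ D))

  -- alphaShift D k = α_{k-1} has (t, y)-coordinates (τ k , η k).
  τ η : ℕ → ℤ
  τ k = Qℤ 0 * + pp D k - Pℤ 0 * + qq D k
  η k = + qq D k

  ppqq-cast : ∀ k → (+ pp D (suc (suc k)) ≡ Aℤ (suc k) * + pp D (suc k) + + pp D k) ×
                    (+ qq D (suc (suc k)) ≡ Aℤ (suc k) * + qq D (suc k) + + qq D k)
  ppqq-cast k = cast (pp D (suc k)) (pp D k) , cast (qq D (suc k)) (qq D k)
    where
    cast : ∀ m n → + (pq D (suc k) ℕ.* m ℕ.+ n) ≡ Aℤ (suc k) * + m + + n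
    cast m n = trans (ℤP.pos-+ (pq D (suc k) ℕ.* m) n) (cong (_+ + n) (ℤP.pos-* (pq D (suc k)) m))

  τ-rec : ∀ k → τ (suc (suc k)) ≡ Aℤ (suc k) * τ (suc k) + τ k
  τ-rec k = trans (cong₂ (λ x y → Qℤ 0 * x - Pℤ 0 * y) (proj₁ (ppqq-cast k)) (proj₂ (ppqq-cast k)))
    (linear (Qℤ 0) (Pℤ 0) (Aℤ (suc k)) (+ pp D (suc k)) (+ pp D k) (+ qq D (suc k)) (+ qq D k))
    where
    linear : ∀ Q₀ P₀ A p₁ p₀ q₁ q₀ →
      Q₀ * (A * p₁ + p₀) - P₀ * (A * q₁ + q₀) ≡ A * (Q₀ * p₁ - P₀ * q₁) + (Q₀ * p₀ - P₀ * q₀)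
    linear = solve-∀

  η-rec : ∀ k → η (suc (suc k)) ≡ Aℤ (suc k) * η (suc k) + η k
  η-rec k = proj₂ (ppqq-cast k)

  -- Writing γ_k = τ k + η k √D, Linked k says Q_{k+1} γ_k = γ_{k+1} (√D - P_{k+1}).
  Linked : ℕ → Set
  Linked k = (Qℤ (suc k) * τ k + Pℤ (suc k) * τ (suc k) - + D * η (suc k) ≡ 0ℤ) ×
             (Qℤ (suc k) * η k - τ (suc k) + Pℤ (suc k) * η (suc k) ≡ 0ℤ)

  linked-0 : Linked 0
  linked-0 =
    trans (rational (Qℤ 0) (Pℤ 0) (Qℤ 1) (Pℤ 1) (Aℤ 0) (+ D))
      (trans (cong₂ (λ x y → y - Pℤ 1 * x) (P-step 0) (Q-step 0)) (vanish (Pℤ 1))) ,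
    trans (irrational (Qℤ 0) (Pℤ 0) (Qℤ 1) (Pℤ 1) (Aℤ 0)) (P-step 0)
    where
    rational : ∀ Q₀ P₀ Q₁ P₁ A₀ D → Q₁ * (Q₀ * + 1 - P₀ * + 0) + P₁ * (Q₀ * A₀ - P₀ * + 1) - D * + 1 ≡
      (Q₀ * Q₁ + P₁ * P₁ - D) - P₁ * (P₁ + P₀ - A₀ * Q₀)
    rational = solve-∀
    vanish : ∀ P → 0ℤ - P * 0ℤ ≡ 0ℤ
    vanish = solve-∀
    irrational : ∀ Q₀ P₀ Q₁ P₁ A₀ → Q₁ * + 0 - (Q₀ * A₀ - P₀ * + 1) + P₁ * + 1 ≡ P₁ + P₀ - A₀ * Q₀
    irrational = solve-∀

  -- Both equations of Linked (suc k), multiplied by Q_{k+1}, are combinations of Linked k and the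
  -- recurrences for P and Q.
  module LinkedStep (k : ℕ) (linked-k : Linked k) where
    Q Q′ P P′ A τ₀ τ₁ η₀ η₁ : ℤ
    Q = Qℤ (suc k)
    Q′ = Qℤ (suc (suc k))
    P = Pℤ (suc k)
    P′ = Pℤ (suc (suc k))
    A = Aℤ (suc k)
    τ₀ = τ k
    τ₁ = τ (suc k)
    η₀ = η k
    η₁ = η (suc k)
    rat : Q * τ₀ + P * τ₁ - + D * η₁ ≡ 0ℤ
    rat = proj₁ linked-k
    irr : Q * η₀ - τ₁ + P * η₁ ≡ 0ℤ
    irr = proj₂ linked-k
    rational : Q * (Q′ * τ₁ + P′ * τ (suc (suc k)) - + D * η (suc (suc k))) ≡ 0ℤ
    rational = trans (cong₂ (λ x y → Q * (Q′ * τ₁ + P′ * x - + D * y)) (τ-rec k) (η-rec k))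
      (trans (combination Q Q′ P P′ A (+ D) τ₀ τ₁ η₀ η₁)
      (trans (cong₄ (λ h₁ h₂ h₃ h₄ → h₄ * τ₁ + P′ * h₁ - + D * h₂ - P′ * τ₁ * h₃ + + D * η₁ * h₃)
        rat irr (P-step (suc k)) (Q-step (suc k)))
      (vanish P′ (+ D) τ₁ η₁)))
      where
      combination : ∀ Q Q′ P P′ A D τ₀ τ₁ η₀ η₁ → Q * (Q′ * τ₁ + P′ * (A * τ₁ + τ₀) - D * (A * η₁ + η₀)) ≡
        (Q * Q′ + P′ * P′ - D) * τ₁ + P′ * (Q * τ₀ + P * τ₁ - D * η₁) - D * (Q * η₀ - τ₁ + P * η₁)
        - P′ * τ₁ * (P′ + P - A * Q) + D * η₁ * (P′ + P - A * Q)
      combination = solve-∀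
      vanish : ∀ P′ D τ₁ η₁ → 0ℤ * τ₁ + P′ * 0ℤ - D * 0ℤ - P′ * τ₁ * 0ℤ + D * η₁ * 0ℤ ≡ 0ℤ
      vanish = solve-∀
    irrational : Q * (Q′ * η₁ - τ (suc (suc k)) + P′ * η (suc (suc k))) ≡ 0ℤ
    irrational = trans (cong₂ (λ x y → Q * (Q′ * η₁ - x + P′ * y)) (τ-rec k) (η-rec k))
      (trans (combination Q Q′ P P′ A (+ D) τ₀ τ₁ η₀ η₁)
      (trans (cong₄ (λ h₁ h₂ h₃ h₄ → h₄ * η₁ - h₁ + P′ * h₂ - P′ * η₁ * h₃ + τ₁ * h₃)
        rat irr (P-step (suc k)) (Q-step (suc k)))
      (vanish P′ τ₁ η₁)))
      where
      combination : ∀ Q Q′ P P′ A D τ₀ τ₁ η₀ η₁ → Q * (Q′ * η₁ - (A * τ₁ + τ₀) + P′ * (A * η₁ + η₀)) ≡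
        (Q * Q′ + P′ * P′ - D) * η₁ - (Q * τ₀ + P * τ₁ - D * η₁) + P′ * (Q * η₀ - τ₁ + P * η₁)
        - P′ * η₁ * (P′ + P - A * Q) + τ₁ * (P′ + P - A * Q)
      combination = solve-∀
      vanish : ∀ P′ τ₁ η₁ → 0ℤ * η₁ - 0ℤ + P′ * 0ℤ - P′ * η₁ * 0ℤ + τ₁ * 0ℤ ≡ 0ℤ
      vanish = solve-∀

  linked-step : ∀ k → Linked k → Linked (suc k)
  linked-step k linked-k = *-cancelˡ-≡0 (0<Qℤ (suc k)) rational , *-cancelˡ-≡0 (0<Qℤ (suc k)) irrational
    where open LinkedStep k linked-k

  linked : ∀ k → Linked k
  linked zero = linked-0
  linked (suc k) = linked-step k (linked k)

  N : ℕ → ℤ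
  N k = τ k * τ k - + D * (η k * η k)

  -- The norm of Linked k: Q_{k+1}² N(γ_k) = N(γ_{k+1}) (P_{k+1}² - D) = - Q_k Q_{k+1} N(γ_{k+1}).
  N-step : ∀ k → Qℤ (suc k) * N k + Qℤ k * N (suc k) ≡ 0ℤ
  N-step k = *-cancelˡ-≡0 (0<Qℤ (suc k)) (trans (factor Q Qₖ P (+ D) τ₀ τ₁ η₀ η₁)
    (trans (cong₂ (λ h₁ h₂ → h₁ * (Q * τ₀ + + D * η₁ - P * τ₁) - + D * (h₂ * (Q * η₀ + τ₁ - P * η₁)) + H * N (suc k))
      (proj₁ (linked k)) (proj₂ (linked k)))
    (trans (cong (λ h → 0ℤ * (Q * τ₀ + + D * η₁ - P * τ₁) - + D * (0ℤ * (Q * η₀ + τ₁ - P * η₁)) + h * N (suc k)) (Q-step k))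
    (vanish (Q * τ₀ + + D * η₁ - P * τ₁) (+ D) (Q * η₀ + τ₁ - P * η₁) (N (suc k))))))
    where
    Q Qₖ P τ₀ τ₁ η₀ η₁ H : ℤ
    Q = Qℤ (suc k)
    Qₖ = Qℤ k
    P = Pℤ (suc k)
    τ₀ = τ k
    τ₁ = τ (suc k)
    η₀ = η k
    η₁ = η (suc k)
    H = Qₖ * Q + P * P - + D
    factor : ∀ Q Qₖ P D τ₀ τ₁ η₀ η₁ → Q * (Q * (τ₀ * τ₀ - D * (η₀ * η₀)) + Qₖ * (τ₁ * τ₁ - D * (η₁ * η₁))) ≡
      (Q * τ₀ + P * τ₁ - D * η₁) * (Q * τ₀ + D * η₁ - P * τ₁) - D * ((Q * η₀ - τ₁ + P * η₁) * (Q * η₀ + τ₁ - P * η₁))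
      + (Qₖ * Q + P * P - D) * (τ₁ * τ₁ - D * (η₁ * η₁))
    factor = solve-∀
    vanish : ∀ a D b n → 0ℤ * a - D * (0ℤ * b) + 0ℤ * n ≡ 0ℤ
    vanish = solve-∀

  alternating : ℕ → ℤ
  alternating zero = 1ℤ
  alternating (suc k) = - alternating k

  N-formula : ∀ k → N k ≡ alternating k * (Qℤ 0 * Qℤ k)
  N-formula zero = initial (Qℤ 0) (Pℤ 0) (+ D)
    where
    initial : ∀ Q₀ P₀ D → (Q₀ * + 1 - P₀ * + 0) * (Q₀ * + 1 - P₀ * + 0) - D * (+ 0 * + 0) ≡ 1ℤ * (Q₀ * Q₀)
    initial = solve-∀
  N-formula (suc k) = ℤP.i-j≡0⇒i≡j _ _ (*-cancelˡ-≡0 (0<Qℤ k) (trans (regroup Q₁ Qₖ (N k) (N (suc k)) (alternating k) (Qℤ 0))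
    (trans (cong₂ (λ a b → a + Q₁ * b) (N-step k) (ℤP.i≡j⇒i-j≡0 (sym (N-formula k)))) (vanish Q₁))))
    where
    Q₁ Qₖ : ℤ
    Q₁ = Qℤ (suc k)
    Qₖ = Qℤ k
    regroup : ∀ Q₁ Qₖ n₀ n₁ σ Q₀ →
      Qₖ * (n₁ - (- σ) * (Q₀ * Q₁)) ≡ (Q₁ * n₀ + Qₖ * n₁) + Q₁ * (σ * (Q₀ * Qₖ) - n₀)
    regroup = solve-∀
    vanish : ∀ Q₁ → 0ℤ + Q₁ * 0ℤ ≡ 0ℤ
    vanish = solve-∀

  alternating-even : ∀ k → alternating (2 ℕ.* k) ≡ 1ℤ
  alternating-even zero = refl
  alternating-even (suc k) rewrite ℕP.+-suc k (k ℕ.+ 0) =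
    trans (ℤP.neg-involutive (alternating (k ℕ.+ (k ℕ.+ 0)))) (alternating-even k)

  α : ℕ → OK
  α = alphaShift D

  tcoord-α : ∀ k → tcoord D (α k) ≡ τ k
  tcoord-α k = tcoordWith-fromξ (one-mod-4 D) (pp D k) (qq D k)

  norm-α : ∀ k → norm D (α k) ≡ N k
  norm-α k = cong₂ (λ t y → t * t - + D * (y * y)) (tcoord-α k) (ycoord-fromξ (one-mod-4 D) (pp D k) (qq D k))

  q≤p : ∀ k → qq D k ℕ.≤ pp D k × 1 ℕ.≤ pp D k
  q≤p zero = z≤n , s≤s z≤n
  q≤p (suc zero) = 1≤pq 0 , 1≤pq 0
  q≤p (suc (suc k)) = ℕP.+-mono-≤ (ℕP.*-monoʳ-≤ (u D (suc k)) (proj₁ (q≤p (suc k)))) (proj₁ (q≤p k)) ,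
    ℕP.≤-trans (proj₂ (q≤p k)) (ℕP.m≤n+m (pp D k) _)

  0<τ : ∀ k → 0ℤ < τ k
  0<τ k = subst (0ℤ <_) (sym τ≡) (ℤP.+-mono-<-≤ (+<+ (proj₂ (q≤p k)))
    (*-nonNeg {Pℤ 0} (+≤+ z≤n) (ℤP.i≤j⇒0≤j-i (+≤+ (proj₁ (q≤p k))))))
    where
    regroup : ∀ P₀ p q → (+ 1 + P₀) * p - P₀ * q ≡ p + P₀ * (p - q)
    regroup = solve-∀
    τ≡ : τ k ≡ + pp D k + Pℤ 0 * (+ pp D k - + qq D k)
    τ≡ = trans (cong (λ Q₀ → + Q₀ * + pp D k - Pℤ 0 * + qq D k) (initial-Q≡1+P (one-mod-4 D)))
      (trans (cong (λ Q₀ → Q₀ * + pp D k - Pℤ 0 * + qq D k) (ℤP.pos-+ 1 (Pₙ 0))) (regroup (Pℤ 0) (+ pp D k) (+ qq D k)))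

  TotallyPositive-α-even : ∀ k → TotallyPositive D (α (2 ℕ.* k))
  TotallyPositive-α-even k = totallyPositive (subst (0ℤ <_) (sym (tcoord-α (2 ℕ.* k))) (0<τ (2 ℕ.* k)))
    (subst (0ℤ <_) (sym (trans (norm-α (2 ℕ.* k)) (trans (N-formula (2 ℕ.* k)) (cong (_* (Qℤ 0 * Qℤ (2 ℕ.* k))) (alternating-even k)))))
      (subst (0ℤ <_) (sym (ℤP.*-identityˡ _)) (*-pos (0<Qℤ 0) (0<Qℤ (2 ℕ.* k)))))

  norm-α-odd<0 : ∀ k → norm D (α (suc (2 ℕ.* k))) < 0ℤ
  norm-α-odd<0 k = subst (_< 0ℤ) (sym (trans (norm-α (suc (2 ℕ.* k)))
    (trans (N-formula (suc (2 ℕ.* k))) (cong (λ σ → - σ * (Qℤ 0 * Qℤ (suc (2 ℕ.* k)))) (alternating-even k)))))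
    (subst (_< 0ℤ) (negate (Qℤ 0 * Qℤ (suc (2 ℕ.* k)))) (ℤP.neg-mono-< (*-pos (0<Qℤ 0) (0<Qℤ (suc (2 ℕ.* k))))))
    where
    negate : ∀ x → - x ≡ - 1ℤ * x
    negate = solve-∀

  0<tcoord-α : ∀ k → 0ℤ < tcoord D (α k)
  0<tcoord-α k = subst (0ℤ <_) (sym (tcoord-α k)) (0<τ k)

  α-rec : ∀ k → α (suc (suc k)) ≡ scale (+ u D (suc k)) (α (suc k)) ⊕ α k
  α-rec k = fromξ-rec (one-mod-4 D) (u D (suc k)) (pp D (suc k)) (pp D k) (qq D (suc k)) (qq D k)

  det-α : ∀ k → det (α k) (α (suc k)) ≡ alternating k
  det-α zero = det-fromξ-initial (one-mod-4 D) (pq D 0)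
  det-α (suc k) = trans (cong (det (α (suc k))) (α-rec k))
    (trans (det-shear (α (suc k)) (α k) (+ u D (suc k))) (cong -_ (det-α k)))

-- The indecomposables β_j

module Indecomposables (D : ℕ) (2≤D : 2 ℕ.≤ D) (sqf : Squarefree D) where

  open ContinuedFraction D 2≤D sqf

  -- β_n = α_{2k-1, r} = α (2k) + r α (2k+1) with (k , r) = idx D n and r < u_{2k+1}.
  k⟨_⟩ r⟨_⟩ : ℕ → ℕ
  k⟨ n ⟩ = proj₁ (idx D n)
  r⟨ n ⟩ = proj₂ (idx D n)

  bound : ℕ → ℕ
  bound k = u D (suc (2 ℕ.* k))

  αᵢᵣ : ℕ → ℕ → OK
  αᵢᵣ k r = α (2 ℕ.* k) ⊕ scale (+ r) (α (suc (2 ℕ.* k)))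

  -- Case splits on the step from idx D n to idx D (suc n) match on an IdxStep argument: a `with`
  -- abstracting over a goal that mentions βℕ makes Agda normalise idx D, which blows up.
  data IdxStep (n : ℕ) : Set where
    same-k : suc r⟨ n ⟩ ℕ.< bound k⟨ n ⟩ → idx D (suc n) ≡ (k⟨ n ⟩ , suc r⟨ n ⟩) → IdxStep n
    next-k : suc r⟨ n ⟩ ≡ bound k⟨ n ⟩ → idx D (suc n) ≡ (suc k⟨ n ⟩ , 0) → IdxStep n

  r<bound : ∀ n → r⟨ n ⟩ ℕ.< bound k⟨ n ⟩
  r<bound zero = 1≤u 1
  r<bound (suc n) with suc r⟨ n ⟩ ℕ.<ᵇ bound k⟨ n ⟩ in lt
  ... | true = ℕP.<ᵇ⇒< _ _ (subst T (sym lt) tt)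
  ... | false = 1≤u (suc (2 ℕ.* suc k⟨ n ⟩))

  idx-step : ∀ n → IdxStep n
  idx-step n with suc r⟨ n ⟩ ℕ.<ᵇ bound k⟨ n ⟩ in lt
  ... | true = same-k (ℕP.<ᵇ⇒< _ _ (subst T (sym lt) tt)) (cong (λ b → if b then (k⟨ n ⟩ , suc r⟨ n ⟩) else (suc k⟨ n ⟩ , 0)) lt)
  ... | false = next-k (ℕP.≤-antisym (r<bound n) (ℕP.≮⇒≥ (λ h → subst T lt (ℕP.<⇒<ᵇ h))))
    (cong (λ b → if b then (k⟨ n ⟩ , suc r⟨ n ⟩) else (suc k⟨ n ⟩ , 0)) lt)

  αᵢᵣ-at : ∀ n {k r} → idx D n ≡ (k , r) → βℕ D n ≡ αᵢᵣ k r
  αᵢᵣ-at n idx≡ = cong (λ kr → αᵢᵣ (proj₁ kr) (proj₂ kr)) idx≡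

  2[1+k]≡ : ∀ k → 2 ℕ.* suc k ≡ suc (suc (2 ℕ.* k))
  2[1+k]≡ k = ℕP.*-suc 2 k

  α-even-suc : ∀ k → α (2 ℕ.* suc k) ≡ scale (+ bound k) (α (suc (2 ℕ.* k))) ⊕ α (2 ℕ.* k)
  α-even-suc k = trans (cong α (2[1+k]≡ k)) (α-rec (2 ℕ.* k))

  α-odd-suc : ∀ k → α (suc (2 ℕ.* suc k)) ≡ scale (+ u D (2 ℕ.* suc k)) (α (2 ℕ.* suc k)) ⊕ α (suc (2 ℕ.* k))
  α-odd-suc k = trans (cong (λ i → α (suc i)) (2[1+k]≡ k)) (trans (α-rec (suc (2 ℕ.* k)))
    (cong₂ (λ x y → scale (+ x) y ⊕ α (suc (2 ℕ.* k))) (cong (u D) (sym (2[1+k]≡ k))) (cong α (sym (2[1+k]≡ k)))))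

  αᵢᵣ-end : ∀ k → αᵢᵣ (suc k) 0 ≡ αᵢᵣ k (bound k)
  αᵢᵣ-end k = trans (⊕-scale-zero (α (2 ℕ.* suc k)) (α (suc (2 ℕ.* suc k))))
    (trans (α-even-suc k) (⊕-comm (scale (+ bound k) (α (suc (2 ℕ.* k)))) (α (2 ℕ.* k))))

  β-suc : ∀ n → βℕ D (suc n) ≡ βℕ D n ⊕ α (suc (2 ℕ.* k⟨ n ⟩))
  β-suc n = by-cases (idx-step n)
    where
    by-cases : IdxStep n → βℕ D (suc n) ≡ βℕ D n ⊕ α (suc (2 ℕ.* k⟨ n ⟩))
    by-cases (same-k _ idx≡) = trans (αᵢᵣ-at (suc n) idx≡) (⊕-scale-suc (α (2 ℕ.* k⟨ n ⟩)) (α (suc (2 ℕ.* k⟨ n ⟩))) r⟨ n ⟩)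
    by-cases (next-k 1+r≡bound idx≡) = trans (αᵢᵣ-at (suc n) idx≡) (trans (αᵢᵣ-end k⟨ n ⟩)
      (trans (cong (αᵢᵣ k⟨ n ⟩) (sym 1+r≡bound)) (⊕-scale-suc (α (2 ℕ.* k⟨ n ⟩)) (α (suc (2 ℕ.* k⟨ n ⟩))) r⟨ n ⟩)))

  TotallyPositive-αᵢᵣ : ∀ k r → r ℕ.< bound k → TotallyPositive D (αᵢᵣ k r)
  TotallyPositive-αᵢᵣ k r r<b = totallyPositive
    (subst (0ℤ <_) (sym (trans (tcoord-⊕ D X (scale (+ r) Z)) (cong (λ x → tcoord D X + x) (tcoord-scale D (+ r) Z))))
      (ℤP.+-mono-<-≤ (0<tcoord-α (2 ℕ.* k)) (*-nonNeg {+ r} (+≤+ z≤n) (ℤP.<⇒≤ (0<tcoord-α (suc (2 ℕ.* k)))))))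
    (norm-pos-between D X Z (+ r) (+ bound k) (+≤+ z≤n) (+≤+ (ℕP.<⇒≤ r<b)) (ℤP.<⇒≤ (norm-α-odd<0 k))
      (norm-pos (TotallyPositive-α-even k))
      (subst (λ w → 0ℤ < norm D w) (trans (α-even-suc k) (⊕-comm (scale (+ bound k) Z) X)) (norm-pos (TotallyPositive-α-even (suc k)))))
    where
    X Z : OK
    X = α (2 ℕ.* k)
    Z = α (suc (2 ℕ.* k))

  TotallyPositive-βℕ : ∀ n → TotallyPositive D (βℕ D n)
  TotallyPositive-βℕ n = TotallyPositive-αᵢᵣ k⟨ n ⟩ r⟨ n ⟩ (r<bound n)

  det-βℕ : ∀ n → det (βℕ D n) (βℕ D (suc n)) ≡ 1ℤ
  det-βℕ n = begin
    det (βℕ D n) (βℕ D (suc n))                       ≡⟨ cong (det (βℕ D n)) (β-suc n) ⟩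
    det (βℕ D n) (βℕ D n ⊕ α (suc (2 ℕ.* k⟨ n ⟩)))    ≡⟨ det-⊕ʳ-self (βℕ D n) _ ⟩
    det (αᵢᵣ k⟨ n ⟩ r⟨ n ⟩) (α (suc (2 ℕ.* k⟨ n ⟩)))  ≡⟨ det-⊕ˡ-scale (α (2 ℕ.* k⟨ n ⟩)) _ (+ r⟨ n ⟩) ⟩
    det (α (2 ℕ.* k⟨ n ⟩)) (α (suc (2 ℕ.* k⟨ n ⟩)))   ≡⟨ det-α (2 ℕ.* k⟨ n ⟩) ⟩
    alternating (2 ℕ.* k⟨ n ⟩)                         ≡⟨ alternating-even k⟨ n ⟩ ⟩
    1ℤ                                                 ∎
    where open ≡-Reasoning

  norm-βℕ-⊖-suc : ∀ n → norm D (βℕ D n ⊖ βℕ D (suc n)) < 0ℤ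
  norm-βℕ-⊖-suc n = subst (_< 0ℤ) (sym (trans (cong (λ w → norm D (βℕ D n ⊖ w)) (β-suc n))
    (trans (cong (norm D) (⊖-⊕ (βℕ D n) _)) (norm-neg D _)))) (norm-α-odd<0 k⟨ n ⟩)

  β₀≡α₀ : βℕ D 0 ≡ α 0
  β₀≡α₀ = ⊕-scale-zero (α 0) (α 1)

  vᵢᵣ : ℕ → ℕ → ℕ
  vᵢᵣ k r = if r ℕ.≡ᵇ 0 then u D (2 ℕ.* k) ℕ.+ 2 else 2

  v-at : ∀ n {k r} → idx D n ≡ (k , r) → v D (+ n) ≡ vᵢᵣ k r
  v-at n idx≡ = cong (λ kr → vᵢᵣ (proj₁ kr) (proj₂ kr)) idx≡

  β-at-new-k : ∀ n {k} → idx D n ≡ (k , 0) → βℕ D n ≡ α (2 ℕ.* k)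
  β-at-new-k n {k} idx≡ = trans (αᵢᵣ-at n idx≡) (⊕-scale-zero (α (2 ℕ.* k)) (α (suc (2 ℕ.* k))))

  relation-βℕ : ∀ m → βℕ D m ⊕ βℕ D (suc (suc m)) ≡ scale (+ v D (+ suc m)) (βℕ D (suc m))
  relation-βℕ m = by-cases (idx-step m)
    where
    by-cases : IdxStep m → βℕ D m ⊕ βℕ D (suc (suc m)) ≡ scale (+ v D (+ suc m)) (βℕ D (suc m))
    by-cases (same-k _ idx≡) = begin
      βℕ D m ⊕ βℕ D (suc (suc m))                 ≡⟨ cong (βℕ D m ⊕_) (trans (β-suc (suc m)) (cong₂ _⊕_ (β-suc m) same-d)) ⟩
      βℕ D m ⊕ ((βℕ D m ⊕ d) ⊕ d)                 ≡⟨ ⊕-double (βℕ D m) d ⟩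
      scale (+ 2) (βℕ D m ⊕ d)                    ≡⟨ cong₂ (λ x y → scale (+ x) y) (sym (v-at (suc m) idx≡)) (sym (β-suc m)) ⟩
      scale (+ v D (+ suc m)) (βℕ D (suc m))      ∎
      where
      open ≡-Reasoning
      d : OK
      d = α (suc (2 ℕ.* k⟨ m ⟩))
      same-d : α (suc (2 ℕ.* k⟨ suc m ⟩)) ≡ d
      same-d = cong (λ k → α (suc (2 ℕ.* k))) (cong proj₁ idx≡)
    by-cases (next-k _ idx≡) = begin
      βℕ D m ⊕ βℕ D (suc (suc m))
        ≡⟨ cong (βℕ D m ⊕_) (trans (β-suc (suc m)) (cong (βℕ D (suc m) ⊕_) next-d)) ⟩
      βℕ D m ⊕ (βℕ D (suc m) ⊕ (scale (+ u D (2 ℕ.* suc k)) (βℕ D (suc m)) ⊕ d))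
        ≡⟨ ⊕-shear (βℕ D m) (βℕ D (suc m)) d (u D (2 ℕ.* suc k)) (β-suc m) ⟩
      scale (+ (u D (2 ℕ.* suc k) ℕ.+ 2)) (βℕ D (suc m))
        ≡⟨ cong (λ x → scale (+ x) (βℕ D (suc m))) (sym (v-at (suc m) idx≡)) ⟩
      scale (+ v D (+ suc m)) (βℕ D (suc m))
        ∎
      where
      open ≡-Reasoning
      k : ℕ
      k = k⟨ m ⟩
      d : OK
      d = α (suc (2 ℕ.* k))
      next-d : α (suc (2 ℕ.* k⟨ suc m ⟩)) ≡ scale (+ u D (2 ℕ.* suc k)) (βℕ D (suc m)) ⊕ d
      next-d = trans (cong (λ k → α (suc (2 ℕ.* k))) (cong proj₁ idx≡))
        (trans (α-odd-suc k) (cong (λ w → scale (+ u D (2 ℕ.* suc k)) w ⊕ d) (sym (β-at-new-k (suc m) idx≡))))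

  odd-decomposition : ∀ k → Σ OK λ X → norm D X < 0ℤ × α (suc (2 ℕ.* k)) ≡ X ⊕ scale (+ u D (2 ℕ.* k)) (α (2 ℕ.* k))
  odd-decomposition zero = neg (conj D (α 1))
    , subst (_< 0ℤ) (sym (trans (norm-neg D (conj D (α 1))) (norm-conj D (α 1)))) (norm-α-odd<0 0)
    , ⊕-solve (conj D (α 1)) (α 1) _ (trace-fromξ (one-mod-4 D) (pq D 0) (1≤pq 0))
  odd-decomposition (suc k) = α (suc (2 ℕ.* k)) , norm-α-odd<0 k
    , trans (α-odd-suc k) (⊕-comm (scale (+ u D (2 ℕ.* suc k)) (α (2 ℕ.* suc k))) (α (suc (2 ℕ.* k))))

  norm-2β-⊖-βℕ-right : ∀ n → 2 ℕ.< v D (+ suc n) → norm D (scale (+ 2) (βℕ D (suc n)) ⊖ βℕ D n) < 0ℤ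
  norm-2β-⊖-βℕ-right n 2<v = by-cases (idx-step n)
    where
    by-cases : IdxStep n → norm D (scale (+ 2) (βℕ D (suc n)) ⊖ βℕ D n) < 0ℤ
    by-cases (same-k _ idx≡) = ⊥-elim (ℕP.<-irrefl refl (subst (2 ℕ.<_) (v-at (suc n) idx≡) 2<v))
    by-cases (next-k _ idx≡) = subst (_< 0ℤ) (sym (cong (norm D) (trans (cong (λ w → scale (+ 2) w ⊖ βℕ D n) (β-suc n))
        (twice-⊖-summand (βℕ D n) d))))
      (subst (λ w → norm D (d ⊕ scale 1ℤ w) < 0ℤ) (sym (trans (sym (β-suc n)) (β-at-new-k (suc n) idx≡)))
        (norm-neg-between D d (α (2 ℕ.* suc k)) 1ℤ (+ u D (2 ℕ.* suc k)) (+≤+ z≤n) (+≤+ (1≤u (2 ℕ.* suc k)))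
          (ℤP.<⇒≤ (norm-pos (TotallyPositive-α-even (suc k)))) (norm-α-odd<0 k)
          (subst (λ w → norm D w < 0ℤ) (trans (α-odd-suc k) (⊕-comm _ d)) (norm-α-odd<0 (suc k)))))
      where
      k : ℕ
      k = k⟨ n ⟩
      d : OK
      d = α (suc (2 ℕ.* k))

  norm-2β-⊖-βℕ-left : ∀ m → 2 ℕ.< v D (+ m) → norm D (scale (+ 2) (βℕ D m) ⊖ βℕ D (suc m)) < 0ℤ
  norm-2β-⊖-βℕ-left m 2<v = subst (_< 0ℤ) (sym (begin
      norm D (scale (+ 2) (βℕ D m) ⊖ βℕ D (suc m))      ≡⟨ cong (λ w → norm D (scale (+ 2) (βℕ D m) ⊖ w)) (β-suc m) ⟩
      norm D (scale (+ 2) (βℕ D m) ⊖ (βℕ D m ⊕ d))      ≡⟨ cong (norm D) (twice-⊖-sum (βℕ D m) d) ⟩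
      norm D (βℕ D m ⊖ d)                                ≡⟨ cong₂ (λ x y → norm D (x ⊖ y)) βm≡ (proj₂ (proj₂ decomposition)) ⟩
      norm D (α (2 ℕ.* k) ⊖ (X ⊕ scale (+ u₂ₖ) (α (2 ℕ.* k))))
        ≡⟨ cong (norm D) (drop-one u₂ₖ (1≤u (2 ℕ.* k))) ⟩
      norm D (neg (X ⊕ scale (+ (u₂ₖ ∸ 1)) (α (2 ℕ.* k)))) ≡⟨ norm-neg D _ ⟩
      norm D (X ⊕ scale (+ (u₂ₖ ∸ 1)) (α (2 ℕ.* k)))    ∎))
    (norm-neg-between D X (α (2 ℕ.* k)) (+ (u₂ₖ ∸ 1)) (+ u₂ₖ) (+≤+ z≤n) (+≤+ (ℕP.m∸n≤m u₂ₖ 1))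
      (ℤP.<⇒≤ (norm-pos (TotallyPositive-α-even k))) (proj₁ (proj₂ decomposition))
      (subst (λ w → norm D w < 0ℤ) (proj₂ (proj₂ decomposition)) (norm-α-odd<0 k)))
    where
    open ≡-Reasoning
    k u₂ₖ : ℕ
    k = k⟨ m ⟩
    u₂ₖ = u D (2 ℕ.* k)
    d : OK
    d = α (suc (2 ℕ.* k))
    decomposition : Σ OK λ X → norm D X < 0ℤ × α (suc (2 ℕ.* k)) ≡ X ⊕ scale (+ u₂ₖ) (α (2 ℕ.* k))
    decomposition = odd-decomposition k
    X : OK
    X = proj₁ decomposition
    drop-one : ∀ n → 1 ℕ.≤ n → α (2 ℕ.* k) ⊖ (X ⊕ scale (+ n) (α (2 ℕ.* k))) ≡ neg (X ⊕ scale (+ (n ∸ 1)) (α (2 ℕ.* k)))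
    drop-one (suc n) _ = ⊖-⊕-scale-suc (α (2 ℕ.* k)) X n
    2<vᵢᵣ⇒r≡0 : ∀ r → 2 ℕ.< vᵢᵣ k r → r ≡ 0
    2<vᵢᵣ⇒r≡0 zero _ = refl
    2<vᵢᵣ⇒r≡0 (suc _) (s≤s (s≤s ()))
    r≡0 : r⟨ m ⟩ ≡ 0
    r≡0 = 2<vᵢᵣ⇒r≡0 r⟨ m ⟩ 2<v
    βm≡ : βℕ D m ≡ α (2 ℕ.* k)
    βm≡ = trans (cong (αᵢᵣ k) r≡0) (⊕-scale-zero (α (2 ℕ.* k)) d)

  β-neg : ∀ j → β D (- j) ≡ conj D (β D j)
  β-neg (+ zero) = sym (trans (cong (conj D) β₀≡α₀) (trans (conjWith-one (one-mod-4 D)) (sym β₀≡α₀)))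
  β-neg (+ suc n) = refl
  β-neg -[1+ n ] = sym (conj-involutive D (βℕ D (suc n)))

  v-neg : ∀ j → v D (- j) ≡ v D j
  v-neg j = cong (λ n → vᵢᵣ k⟨ n ⟩ r⟨ n ⟩) (ℤP.∣-i∣≡∣i∣ j)

  TotallyPositive-β : ∀ j → TotallyPositive D (β D j)
  TotallyPositive-β (+ n) = TotallyPositive-βℕ n
  TotallyPositive-β -[1+ n ] = TotallyPositive-conj (TotallyPositive-βℕ (suc n))

  record Frame (j : ℤ) : Set where
    field
      unimodular : det (β D (j - + 1)) (β D j) * det (β D (j - + 1)) (β D j) ≡ 1ℤ
      relation : β D (j - + 1) ⊕ β D (j + + 1) ≡ scale (+ v D j) (β D j)
      N[β₋-β]<0 : norm D (β D (j - + 1) ⊖ β D j) < 0ℤ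
      N[β₊-β]<0 : norm D (β D (j + + 1) ⊖ β D j) < 0ℤ
      N[2β₊-β]<0 : 2 ℕ.< v D (j + + 1) → norm D (scale (+ 2) (β D (j + + 1)) ⊖ β D j) < 0ℤ
      N[2β₋-β]<0 : 2 ℕ.< v D (j - + 1) → norm D (scale (+ 2) (β D (j - + 1)) ⊖ β D j) < 0ℤ

  frame-0 : Frame (+ 0)
  frame-0 = record
    { unimodular = cong (λ x → x * x) det≡1
    ; relation = begin
        conj D (βℕ D 1) ⊕ βℕ D 1
          ≡⟨ cong (λ b → conj D b ⊕ b) (trans (β-suc 0) (cong (_⊕ α 1) β₀≡α₀)) ⟩
        conj D (α 0 ⊕ α 1) ⊕ (α 0 ⊕ α 1)
          ≡⟨ cong (_⊕ (α 0 ⊕ α 1)) (trans (conj-⊕ D (α 0) (α 1)) (cong (_⊕ conj D (α 1)) (conjWith-one (one-mod-4 D)))) ⟩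
        (α 0 ⊕ conj D (α 1)) ⊕ (α 0 ⊕ α 1)
          ≡⟨ ⊕-trace (α 0) (conj D (α 1)) (α 1) (+ u D 0) (trace-fromξ (one-mod-4 D) (pq D 0) (1≤pq 0)) ⟩
        scale (+ u D 0 + + 2) (α 0)
          ≡⟨ cong₂ scale (sym (ℤP.pos-+ (u D 0) 2)) (sym β₀≡α₀) ⟩
        scale (+ v D (+ 0)) (βℕ D 0)
          ∎
    ; N[β₋-β]<0 = subst (_< 0ℤ) (sym (trans (cong (λ b → norm D (conj D (βℕ D 1) ⊖ b)) (β-neg (+ 0)))
        (trans (norm-⊖-conj D (βℕ D 1) (βℕ D 0)) (norm-⊖-comm D (βℕ D 1) (βℕ D 0))))) (norm-βℕ-⊖-suc 0)
    ; N[β₊-β]<0 = subst (_< 0ℤ) (norm-⊖-comm D (βℕ D 0) (βℕ D 1)) (norm-βℕ-⊖-suc 0)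
    ; N[2β₊-β]<0 = norm-2β-⊖-βℕ-right 0
    ; N[2β₋-β]<0 = λ 2<v → subst (_< 0ℤ) (sym (trans (cong (λ b → norm D (scale (+ 2) (conj D (βℕ D 1)) ⊖ b)) (β-neg (+ 0)))
        (norm-scale-⊖-conj D (+ 2) (βℕ D 1) (βℕ D 0)))) (norm-2β-⊖-βℕ-right 0 2<v)
    }
    where
    open ≡-Reasoning
    det≡1 : det (conj D (βℕ D 1)) (βℕ D 0) ≡ 1ℤ
    det≡1 = begin
      det (conj D (βℕ D 1)) (βℕ D 0)            ≡⟨ cong (det (conj D (βℕ D 1))) (β-neg (+ 0)) ⟩
      det (conj D (βℕ D 1)) (conj D (βℕ D 0))   ≡⟨ det-conj D (βℕ D 1) (βℕ D 0) ⟩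
      - det (βℕ D 1) (βℕ D 0)                   ≡⟨ cong -_ (det-swap (βℕ D 1) (βℕ D 0)) ⟩
      - - det (βℕ D 0) (βℕ D 1)                 ≡⟨ ℤP.neg-involutive _ ⟩
      det (βℕ D 0) (βℕ D 1)                     ≡⟨ det-βℕ 0 ⟩
      1ℤ                                        ∎

  frame-suc : ∀ m → Frame (+ suc m)
  frame-suc m = record
    { unimodular = cong (λ x → x * x) (det-βℕ m)
    ; relation = subst (λ w → βℕ D m ⊕ w ≡ scale (+ v D (+ suc m)) (βℕ D (suc m))) (sym β-next) (relation-βℕ m)
    ; N[β₋-β]<0 = norm-βℕ-⊖-suc m
    ; N[β₊-β]<0 = subst (_< 0ℤ) (sym (trans (cong (λ w → norm D (w ⊖ βℕ D (suc m))) β-next)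
        (norm-⊖-comm D (βℕ D (suc (suc m))) (βℕ D (suc m))))) (norm-βℕ-⊖-suc (suc m))
    ; N[2β₊-β]<0 = λ 2<v → subst (λ w → norm D (scale (+ 2) w ⊖ βℕ D (suc m)) < 0ℤ) (sym β-next)
        (norm-2β-⊖-βℕ-right (suc m) (subst (2 ℕ.<_) (cong (v D) 1+m+1≡) 2<v))
    ; N[2β₋-β]<0 = norm-2β-⊖-βℕ-left m
    }
    where
    1+m+1≡ : + suc m + + 1 ≡ + suc (suc m)
    1+m+1≡ = cong +_ (ℕP.+-comm (suc m) 1)
    β-next : β D (+ suc m + + 1) ≡ βℕ D (suc (suc m))
    β-next = cong (β D) 1+m+1≡

  frame-reflect : ∀ j → Frame (- j) → Frame j
  frame-reflect j F = record
    { unimodular = trans (cong (λ x → x * x) (trans (cong₂ det β₋≡ β≡) (det-conj D f′ e′)))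
        (trans (square-neg (det f′ e′)) (trans (cong (λ x → x * x) (det-relation g′ e′ f′ (+ v D (- j)) (relation F)))
        (trans (square-neg (det g′ e′)) (unimodular F))))
    ; relation = begin
        β D (j - + 1) ⊕ β D (j + + 1)      ≡⟨ cong₂ _⊕_ β₋≡ β₊≡ ⟩
        conj D f′ ⊕ conj D g′              ≡⟨ conj-⊕ D f′ g′ ⟨
        conj D (f′ ⊕ g′)                   ≡⟨ cong (conj D) (trans (⊕-comm f′ g′) (relation F)) ⟩
        conj D (scale (+ v D (- j)) e′)    ≡⟨ conj-scale D (+ v D (- j)) e′ ⟩
        scale (+ v D (- j)) (conj D e′)    ≡⟨ cong₂ (λ n x → scale (+ n) x) (v-neg j) (sym β≡) ⟩
        scale (+ v D j) (β D j)            ∎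
    ; N[β₋-β]<0 = subst (_< 0ℤ) (sym (trans (cong₂ (λ x y → norm D (x ⊖ y)) β₋≡ β≡) (norm-⊖-conj D f′ e′))) (N[β₊-β]<0 F)
    ; N[β₊-β]<0 = subst (_< 0ℤ) (sym (trans (cong₂ (λ x y → norm D (x ⊖ y)) β₊≡ β≡) (norm-⊖-conj D g′ e′))) (N[β₋-β]<0 F)
    ; N[2β₊-β]<0 = λ 2<v → subst (_< 0ℤ) (sym (trans (cong₂ (λ x y → norm D (scale (+ 2) x ⊖ y)) β₊≡ β≡)
        (norm-scale-⊖-conj D (+ 2) g′ e′))) (N[2β₋-β]<0 F (subst (2 ℕ.<_) (trans (cong (v D) (j+1≡ j)) (v-neg (- j - + 1))) 2<v))
    ; N[2β₋-β]<0 = λ 2<v → subst (_< 0ℤ) (sym (trans (cong₂ (λ x y → norm D (scale (+ 2) x ⊖ y)) β₋≡ β≡)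
        (norm-scale-⊖-conj D (+ 2) f′ e′))) (N[2β₊-β]<0 F (subst (2 ℕ.<_) (trans (cong (v D) (j-1≡ j)) (v-neg (- j + + 1))) 2<v))
    }
    where
    open Frame
    open ≡-Reasoning
    g′ e′ f′ : OK
    g′ = β D (- j - + 1)
    e′ = β D (- j)
    f′ = β D (- j + + 1)
    j-1≡ : ∀ j → j - + 1 ≡ - (- j + + 1)
    j-1≡ = solve-∀
    j+1≡ : ∀ j → j + + 1 ≡ - (- j - + 1)
    j+1≡ = solve-∀
    β₋≡ : β D (j - + 1) ≡ conj D f′
    β₋≡ = trans (cong (β D) (j-1≡ j)) (β-neg (- j + + 1))
    β₊≡ : β D (j + + 1) ≡ conj D g′
    β₊≡ = trans (cong (β D) (j+1≡ j)) (β-neg (- j - + 1))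
    β≡ : β D j ≡ conj D e′
    β≡ = trans (cong (β D) (sym (ℤP.neg-involutive j))) (β-neg (- j))

  frame : ∀ j → Frame j
  frame (+ zero) = frame-0
  frame (+ suc m) = frame-suc m
  frame -[1+ m ] = frame-reflect -[1+ m ] (frame-suc m)

  2β₋-β≡β₋₋ : ∀ j → v D (j - + 1) ≡ 2 → scale (+ 2) (β D (j - + 1)) ⊖ β D j ≡ β D (j - + 1 - + 1)
  2β₋-β≡β₋₋ j v₋≡2 = ⊕≡⇒⊖ʳ (subst₂ (λ i n → β D (j - + 1 - + 1) ⊕ β D i ≡ scale (+ n) (β D (j - + 1)))
    (back j) v₋≡2 (Frame.relation (frame (j - + 1))))
    where
    back : ∀ j → j - + 1 + + 1 ≡ j
    back = solve-∀

  2β₊-β≡β₊₊ : ∀ j → v D (j + + 1) ≡ 2 → scale (+ 2) (β D (j + + 1)) ⊖ β D j ≡ β D (j + + 1 + + 1)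
  2β₊-β≡β₊₊ j v₊≡2 = ⊕≡⇒⊖ˡ (subst₂ (λ i n → β D i ⊕ β D (j + + 1 + + 1) ≡ scale (+ n) (β D (j + + 1)))
    (back j) v₊≡2 (Frame.relation (frame (j + + 1))))
    where
    back : ∀ j → j + + 1 - + 1 ≡ j
    back = solve-∀

lemma7p4 : (D : ℕ) → 2 ℕ.≤ D → Squarefree D → (j : ℤ) →
    ((4 ℕ.≤ v D j → Fin 3 ⤖ Partition D (scale (+ 3) (β D j)))
    × (v D j ≡ 3 → Fin 4 ⤖ Partition D (scale (+ 3) (β D j)))
    × (v D j ≡ 2 → 2 ℕ.< v D (j - + 1) → 2 ℕ.< v D (j + + 1) →
    Fin 6 ⤖ Partition D (scale (+ 3) (β D j)))
    × (v D j ≡ 2 → (v D (j - + 1) ≡ 2 ⊎ v D (j + + 1) ≡ 2) →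
    Fin 8 ↣ Partition D (scale (+ 3) (β D j))))
lemma7p4 D 2≤D sqf j = case-v≥4 , case-v≡3 , case-v≡2 , case-v≡2-neighbour
  where
  open Indecomposables D 2≤D sqf
  open Frame (frame j)
  open Configurations D (β D (j - + 1)) (β D j) (β D (j + + 1)) unimodular
    (TotallyPositive-β (j - + 1)) (TotallyPositive-β j) (TotallyPositive-β (j + + 1)) N[β₋-β]<0

  relation-at : ∀ {n} → v D j ≡ n → β D (j - + 1) ⊕ β D (j + + 1) ≡ scale (+ n) (β D j)
  relation-at refl = relation

  case-v≥4 : 4 ℕ.≤ v D j → Fin 3 ⤖ Partition D (scale (+ 3) (β D j))
  case-v≥4 4≤v = count-v≥4 (v D j ∸ 2) (ℕP.∸-monoˡ-≤ 2 4≤v)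
    (relation-at (sym (ℕP.m+[n∸m]≡n (ℕP.≤-trans (s≤s (s≤s z≤n)) 4≤v)))) N[β₊-β]<0
  case-v≡3 : v D j ≡ 3 → Fin 4 ⤖ Partition D (scale (+ 3) (β D j))
  case-v≡3 v≡3 = count-v≡3 (relation-at v≡3) N[β₊-β]<0
  case-v≡2 : v D j ≡ 2 → 2 ℕ.< v D (j - + 1) → 2 ℕ.< v D (j + + 1) → Fin 6 ⤖ Partition D (scale (+ 3) (β D j))
  case-v≡2 v≡2 2<v₋ 2<v₊ = count-v≡2 (relation-at v≡2) (N[2β₋-β]<0 2<v₋) (N[2β₊-β]<0 2<v₊)
  case-v≡2-neighbour : v D j ≡ 2 → v D (j - + 1) ≡ 2 ⊎ v D (j + + 1) ≡ 2 → Fin 8 ↣ Partition D (scale (+ 3) (β D j))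
  case-v≡2-neighbour v≡2 (inj₁ v₋≡2) = count-v≡2-left (relation-at v≡2)
    (subst (TotallyPositive D) (sym (2β₋-β≡β₋₋ j v₋≡2)) (TotallyPositive-β (j - + 1 - + 1)))
  case-v≡2-neighbour v≡2 (inj₂ v₊≡2) = count-v≡2-right (relation-at v≡2)
    (subst (TotallyPositive D) (sym (2β₊-β≡β₊₊ j v₊≡2)) (TotallyPositive-β (j + + 1 + + 1)))
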